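{- Let $G=(V,E)$ be a $uv$-sparse graph, where $u,v\in V$ are distinct. Let $z\in V-\{u,v\}$ be a vertex of degree 3 with $N(z)=\{v_1,v_2,v_3\}$, $|N(z)\cap\{u,v\}|\le1$ and $G[N(z)\cup\{z\}]$ isomorphic to $K_4$. Suppose there is a vertex $x\in V-\{z,v_1,v_2,v_3\}$ with $N(x)\cap N(z)=\{v_2,v_3\}$ and $\{v_1,x\}\ne\{u,v\}$. Then the 4-cycle contraction which merges $z$ into $x$, i.e. the graph $G'=G-z+xv_1$, is $uv$-sparse.
   Context: $N(w)$ is the neighbour set of $w$ and $G[S]$ the induced subgraph. $i(X)$ counts edges with both ends in $X\subseteq V$; for a family $\mathcal{H}=\{H_1,\dots,H_k\}$, $i(\mathcal{H})$ counts edges with both ends in some $H_j$. For nonempty $H\subseteq V$, $\mathrm{val}(H)=2|H|-t_H$ with $t_H=4$ if $H=\{u,v\}$, $t_H=3$ if $H\ne\{u,v\}$ and $|H|\in\{2,3\}$, $t_H=2$ otherwise. $\mathcal{H}$ is $uv$-compatible if $u,v\in H_j$ and $|H_j|\ge3$ for all $j$, with $\mathrm{val}(\mathcal{H})=\sum_j\mathrm{val}(H_j)-2(k-1)$. A graph is $uv$-sparse if $i(H)\le\mathrm{val}(H)$ for all vertex sets $H$ with $|H|\ge2$ and $i(\mathcal{H})\le\mathrm{val}(\mathcal{H})$ for all $uv$-compatible families $\mathcal{H}$. -}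

module Defs where

open import Data.Nat as ℕ using (ℕ; _<ᵇ_; _≤ᵇ_; _≡ᵇ_)
open import Data.Integer as ℤ using (ℤ; +_; _-_)
open import Data.Bool using (Bool; true; false; _∧_; _∨_; not; if_then_else_)
open import Data.Fin using (Fin; toℕ) renaming (_≟_ to _≟ᶠ_)
open import Data.Fin.Subset using (Subset; ∣_∣; ⁅_⁆; _∪_; _⊆_; _∈_; ∁)
open import Data.Vec using (lookup)
open import Data.Vec.Properties using (≡-dec)
open import Data.Bool.Properties using () renaming (_≟_ to _≟ᵇ_)
open import Data.List using (List; []; _∷_; map; allFin; length)
open import Data.Nat.ListAction using (sum)
open import Data.Bool.ListAction using (any)
open import Data.List.Relation.Unary.All using (All)
open import Data.List.Relation.Unary.Unique.Propositional using (Unique)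
open import Relation.Nullary.Decidable using (isYes)
open import Relation.Binary.PropositionalEquality using (_≡_; _≢_)
open import Data.Product using (_×_)
open import Data.Sum using (_⊎_)

-- A graph on vertex set (a subset of) Fin n is given by a Bool-valued adjacency.
Adj : ℕ → Set
Adj n = Fin n → Fin n → Bool

record IsSimple {n : ℕ} (adj : Adj n) : Set where
  field
    sym    : ∀ a b → adj a b ≡ adj b a
    irrefl : ∀ a → adj a a ≡ false

count2 : {n : ℕ} → (Fin n → Fin n → Bool) → ℕ
count2 {n} f = sum (map (λ a → sum (map (λ b → if f a b then 1 else 0) (allFin n))) (allFin n))

-- each edge {a,b} counted once, as the pair with toℕ a < toℕ b
isEdge : {n : ℕ} → Adj n → Fin n → Fin n → Bool
isEdge adj a b = (toℕ a <ᵇ toℕ b) ∧ adj a b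

iSet : {n : ℕ} → Adj n → Subset n → ℕ
iSet adj X = count2 (λ a b → isEdge adj a b ∧ lookup X a ∧ lookup X b)

iFam : {n : ℕ} → Adj n → List (Subset n) → ℕ
iFam adj Hs = count2 (λ a b → isEdge adj a b ∧ any (λ X → lookup X a ∧ lookup X b) Hs)

tH : {n : ℕ} → Fin n → Fin n → Subset n → ℕ
tH u v H =
  if isYes (≡-dec _≟ᵇ_ H (⁅ u ⁆ ∪ ⁅ v ⁆)) then 4
  else if (2 ≤ᵇ ∣ H ∣) ∧ (∣ H ∣ ≤ᵇ 3) then 3
  else 2

val : {n : ℕ} → Fin n → Fin n → Subset n → ℤ
val u v H = + (2 ℕ.* ∣ H ∣) - + tH u v H

sumℤ : List ℤ → ℤ
sumℤ [] = + 0
sumℤ (x ∷ xs) = x ℤ.+ sumℤ xs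

valFam : {n : ℕ} → Fin n → Fin n → List (Subset n) → ℤ
valFam u v Hs = sumℤ (map (val u v) Hs) - (+ (2 ℕ.* length Hs) - + 2)

UVCompatible : {n : ℕ} → Subset n → Fin n → Fin n → List (Subset n) → Set
UVCompatible W u v Hs =
  (1 ℕ.≤ length Hs) × Unique Hs ×
  All (λ H → H ⊆ W × u ∈ H × v ∈ H × 3 ℕ.≤ ∣ H ∣) Hs

UVSparse : {n : ℕ} → Subset n → Adj n → Fin n → Fin n → Set
UVSparse {n} W adj u v =
  (∀ (H : Subset n) → H ⊆ W → 2 ℕ.≤ ∣ H ∣ → + iSet adj H ℤ.≤ val u v H) ×
  (∀ (Hs : List (Subset n)) → UVCompatible W u v Hs → + iFam adj Hs ℤ.≤ valFam u v Hs)

contract4 : {n : ℕ} → Adj n → (z x v₁ : Fin n) → Adj n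
contract4 adj z x v₁ a b =
  (adj a b ∧ not (isYes (a ≟ᶠ z)) ∧ not (isYes (b ≟ᶠ z)))
  ∨ (isYes (a ≟ᶠ x) ∧ isYes (b ≟ᶠ v₁))
  ∨ (isYes (a ≟ᶠ v₁) ∧ isYes (b ≟ᶠ x))

-- A set H of G′ = G − z + xv₁ that misses x or v₁ spans no more edges in G′ than in G.  If H contains
-- both, compare it with H ∪ {z, x, v₁, v₂, v₃} in G: the three edges at z, together with those of
-- xv₂, xv₃, v₁v₂, v₁v₃, v₂v₃ that H misses, pay for the new edge xv₁ and for the at most
-- 1 + [v₂ ∉ H] + [v₃ ∉ H] added vertices.  For a uv-compatible family one of whose members contains
-- x and v₁, the members M meeting Q = {x, v₁, v₂, v₃} ∖ {u, v} are merged into the single set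
-- U = {u, v} ∪ {z, x, v₁, v₂, v₃} ∪ ⋃M, and sparsity of G is applied to U together with the other
-- members.  Counting the vertices of U against those of M reduces to a balance on the four vertices of
-- Q, each classified by how it meets M; a finite check over these classifications shows that the
-- deficit is paid by the edges among x, v₁, v₂, v₃ that no member covers.

module Submission where

open import Defs
open import Data.Nat using (ℕ)
open import Data.Bool using (true; false)
open import Data.Fin using (Fin)
open import Data.Fin.Subset using (⊤; ⁅_⁆; ∁)
open import Data.Product using (_×_)
open import Data.Sum using (_⊎_)
open import Relation.Nullary using (¬_)
open import Relation.Binary.PropositionalEquality using (_≡_; _≢_)
open import Function.Bundles using (_⇔_)

module ListSums where

  open import Data.Nat using (_+_; _*_; _≤_; z≤n)
  open import Data.Nat.Properties
    using (*-distribˡ-+; *-suc; *-zeroʳ; +-assoc; +-mono-≤; m≤m+n; m≤n+m; ≤-refl; ≤-reflexive; ≤-trans; +-commutativeSemigroup)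
  open import Algebra.Properties.CommutativeSemigroup +-commutativeSemigroup using (interchange; x∙yz≈y∙xz)
  open import Data.Bool using (Bool; if_then_else_; _∧_; not)
  open import Data.Bool.Properties using (∨-zeroʳ)
  open import Data.List using (List; []; _∷_; map; length; filterᵇ)
  open import Data.List.Membership.Propositional using (_∈_)
  open import Data.List.Relation.Unary.Any using (here; there)
  open import Data.Nat.ListAction using (sum)
  open import Data.Bool.ListAction using (any)
  open import Data.Product using (_,_; ∃-syntax)
  open import Relation.Binary.PropositionalEquality
  open import Function using (_∘_)

  -- Literally the summand of count2, so count2 f is ∑∑ (λ a b → ind (f a b)) by definition.
  ind : Bool → ℕ
  ind b = if b then 1 else 0

  ind≤1 : ∀ b → ind b ≤ 1
  ind≤1 true  = ≤-refl
  ind≤1 false = z≤n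

  if-≤ : ∀ b k → (if b then k else 0) ≤ k
  if-≤ true  k = ≤-refl
  if-≤ false k = z≤n

  module _ {A : Set} where

    sum-map-+ : ∀ (f g : A → ℕ) xs → sum (map (λ a → f a + g a) xs) ≡ sum (map f xs) + sum (map g xs)
    sum-map-+ f g []       = refl
    sum-map-+ f g (a ∷ xs) rewrite sum-map-+ f g xs = interchange (f a) (g a) _ _

    sum-map-mono-≤ : ∀ {f g : A → ℕ} xs → (∀ {a} → a ∈ xs → f a ≤ g a) → sum (map f xs) ≤ sum (map g xs)
    sum-map-mono-≤ []       le = z≤n
    sum-map-mono-≤ (a ∷ xs) le = +-mono-≤ (le (here refl)) (sum-map-mono-≤ xs (le ∘ there))

    sum-map-cong : ∀ {f g : A → ℕ} xs → (∀ {a} → a ∈ xs → f a ≡ g a) → sum (map f xs) ≡ sum (map g xs)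
    sum-map-cong []       eq = refl
    sum-map-cong (a ∷ xs) eq = cong₂ _+_ (eq (here refl)) (sum-map-cong xs (eq ∘ there))

    ∈⇒≤sum-map : ∀ (f : A → ℕ) {a xs} → a ∈ xs → f a ≤ sum (map f xs)
    ∈⇒≤sum-map f (here refl) = m≤m+n _ _
    ∈⇒≤sum-map f {xs = b ∷ _} (there a∈xs) = ≤-trans (∈⇒≤sum-map f a∈xs) (m≤n+m _ (f b))

    sum-map-const : ∀ k (xs : List A) → sum (map (λ _ → k) xs) ≡ k * length xs
    sum-map-const k []       = sym (*-zeroʳ k)
    sum-map-const k (a ∷ xs) = trans (cong (k +_) (sum-map-const k xs)) (sym (*-suc k (length xs)))

    sum-map-* : ∀ k (f : A → ℕ) xs → sum (map (λ a → k * f a) xs) ≡ k * sum (map f xs)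
    sum-map-* k f []       = sym (*-zeroʳ k)
    sum-map-* k f (a ∷ xs) = trans (cong (k * f a +_) (sum-map-* k f xs)) (sym (*-distribˡ-+ k (f a) _))

    sum-map-filterᵇ : ∀ (f : A → ℕ) (p : A → Bool) xs →
      sum (map f xs) ≡ sum (map f (filterᵇ p xs)) + sum (map f (filterᵇ (not ∘ p) xs))
    sum-map-filterᵇ f p []       = refl
    sum-map-filterᵇ f p (a ∷ xs) with p a
    ... | true  = trans (cong (f a +_) (sum-map-filterᵇ f p xs)) (sym (+-assoc (f a) _ _))
    ... | false = trans (cong (f a +_) (sum-map-filterᵇ f p xs)) (x∙yz≈y∙xz (f a) (sum (map f (filterᵇ p xs))) _)

    any⁺ : ∀ (f : A → Bool) {a xs} → a ∈ xs → f a ≡ true → any f xs ≡ true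
    any⁺ f (here refl) fa rewrite fa = refl
    any⁺ f {xs = b ∷ _} (there a∈xs) fa rewrite any⁺ f a∈xs fa = ∨-zeroʳ (f b)

    any⁻ : ∀ (f : A → Bool) xs → any f xs ≡ true → ∃[ a ] (a ∈ xs × f a ≡ true)
    any⁻ f (a ∷ xs) any≡ with f a in fa
    ... | true  = a , here refl , fa
    ... | false with any⁻ f xs any≡
    ...   | b , b∈xs , fb = b , there b∈xs , fb

    sum-map-ind-any-false : ∀ (f : A → Bool) xs → any f xs ≡ false → sum (map (λ a → ind (f a)) xs) ≡ 0
    sum-map-ind-any-false f []       _ = refl
    sum-map-ind-any-false f (a ∷ xs) any≡ with f a
    ... | false = sum-map-ind-any-false f xs any≡

    sum-map-ind-any-true : ∀ (f : A → Bool) xs → any f xs ≡ true → 1 ≤ sum (map (λ a → ind (f a)) xs)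
    sum-map-ind-any-true f xs any≡ with any⁻ f xs any≡
    ... | a , a∈xs , fa = ≤-trans (≤-reflexive (cong ind (sym fa))) (∈⇒≤sum-map (λ a → ind (f a)) a∈xs)

    ind-≤-sum-map-any : ∀ (f : A → Bool) xs → any f xs ≡ true → ∀ c → ind c ≤ sum (map (λ a → ind (f a ∧ c)) xs)
    ind-≤-sum-map-any f xs any≡ false = z≤n
    ind-≤-sum-map-any f xs any≡ true with any⁻ f xs any≡
    ... | a , a∈xs , fa = ≤-trans (≤-reflexive (cong (λ b → ind (b ∧ true)) (sym fa)))
                                  (∈⇒≤sum-map (λ a → ind (f a ∧ true)) a∈xs)

  sum-map-swap : ∀ {A B : Set} (f : A → B → ℕ) xs (ys : List B) →
    sum (map (λ a → sum (map (f a) ys)) xs) ≡ sum (map (λ b → sum (map (λ a → f a b) xs)) ys)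
  sum-map-swap f []       ys = sym (sum-map-const 0 ys)
  sum-map-swap f (a ∷ xs) ys = trans (cong (sum (map (f a) ys) +_) (sum-map-swap f xs ys))
                                     (sym (sum-map-+ (f a) (λ b → sum (map (λ a′ → f a′ b) xs)) ys))

module FinSums where

  open ListSums
  open import Data.Nat using (zero; suc; _+_; _≤_; z≤n)
  open import Data.Nat.Properties using (+-identityʳ; ≤-trans; +-assoc; +-monoʳ-≤; m≤n+m; module ≤-Reasoning)
  open import Data.Bool using (Bool; if_then_else_; _∨_)
  open import Data.Bool.Properties using (∨-zeroʳ)
  open import Data.Fin using () renaming (zero to fzero; suc to fsuc; _≟_ to _≟ᶠ_)
  open import Data.Fin.Properties using () renaming (suc-injective to fsuc-injective)
  open import Data.List using (List; []; _∷_; map; allFin)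
  open import Data.List.Properties using (map-tabulate; map-cong)
  open import Data.List.Membership.Propositional using (_∈_)
  open import Data.List.Relation.Unary.Any using (here; there)
  open import Data.List.Relation.Unary.All using (All; []; _∷_)
  open import Data.List.Relation.Unary.AllPairs using ([]; _∷_)
  open import Data.List.Relation.Unary.Unique.Propositional using (Unique)
  open import Data.Nat.ListAction using (sum)
  open import Data.Bool.ListAction using (any)
  open import Relation.Nullary.Decidable using (isYes; isYes≗does; dec-true; dec-false; yes)
  open import Relation.Binary.PropositionalEquality
  open import Function using (_∘_; id)

  ∑ : {n : ℕ} → (Fin n → ℕ) → ℕ
  ∑ {n} f = sum (map f (allFin n))

  module _ {n : ℕ} where

    ∑-suc : (f : Fin (suc n) → ℕ) → ∑ f ≡ f fzero + ∑ (f ∘ fsuc)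
    ∑-suc f = cong (λ l → f fzero + sum l) (trans (map-tabulate fsuc f) (sym (map-tabulate id (f ∘ fsuc))))

    ∑-cong : {f g : Fin n → ℕ} → (∀ a → f a ≡ g a) → ∑ f ≡ ∑ g
    ∑-cong eq = cong sum (map-cong eq (allFin n))

    ∑-mono-≤ : {f g : Fin n → ℕ} → (∀ a → f a ≤ g a) → ∑ f ≤ ∑ g
    ∑-mono-≤ le = sum-map-mono-≤ (allFin n) λ {a} _ → le a

    ∑-distrib-+ : (f g : Fin n → ℕ) → ∑ (λ a → f a + g a) ≡ ∑ f + ∑ g
    ∑-distrib-+ f g = sum-map-+ f g (allFin n)

    ∑-zero : ∑ {n} (λ _ → 0) ≡ 0
    ∑-zero = sum-map-const 0 (allFin n)

    ∑-if : ∀ b (f : Fin n → ℕ) → ∑ (λ a → if b then f a else 0) ≡ (if b then ∑ f else 0)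
    ∑-if true  f = refl
    ∑-if false f = ∑-zero

    ∑-sum-map : {A : Set} (f : A → Fin n → ℕ) (xs : List A) →
      ∑ (λ a → sum (map (λ y → f y a) xs)) ≡ sum (map (λ y → ∑ (f y)) xs)
    ∑-sum-map f []       = ∑-zero
    ∑-sum-map f (y ∷ xs) = trans (∑-distrib-+ (f y) _) (cong (∑ (f y) +_) (∑-sum-map f xs))

  ∑-supported : ∀ {n} (p : Fin n) (f : Fin n → ℕ) → (∀ a → a ≢ p → f a ≡ 0) → ∑ f ≡ f p
  ∑-supported {suc n} fzero f off = begin
    ∑ f                    ≡⟨ ∑-suc f ⟩
    f fzero + ∑ (f ∘ fsuc) ≡⟨ cong (f fzero +_) (trans (∑-cong (λ a → off (fsuc a) λ ())) (∑-zero {n})) ⟩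
    f fzero + 0            ≡⟨ +-identityʳ _ ⟩
    f fzero                ∎
    where open ≡-Reasoning
  ∑-supported {suc n} (fsuc p) f off = begin
    ∑ f                    ≡⟨ ∑-suc f ⟩
    f fzero + ∑ (f ∘ fsuc) ≡⟨ cong₂ _+_ (off fzero λ ()) (∑-supported p (f ∘ fsuc) λ a a≢p → off (fsuc a) (a≢p ∘ fsuc-injective)) ⟩
    f (fsuc p)             ∎
    where open ≡-Reasoning

  _==_ : {n : ℕ} → Fin n → Fin n → Bool
  a == b = isYes (a ≟ᶠ b)

  _∈ᵇ_ : {n : ℕ} → Fin n → List (Fin n) → Bool
  a ∈ᵇ xs = any (a ==_) xs

  module _ {n : ℕ} where

    ==-refl : (a : Fin n) → (a == a) ≡ true
    ==-refl a = trans (isYes≗does (a ≟ᶠ a)) (dec-true (a ≟ᶠ a) refl)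

    ==-≢ : {a b : Fin n} → a ≢ b → (a == b) ≡ false
    ==-≢ {a} {b} a≢b = trans (isYes≗does (a ≟ᶠ b)) (dec-false (a ≟ᶠ b) a≢b)

    ==⇒≡ : {a b : Fin n} → (a == b) ≡ true → a ≡ b
    ==⇒≡ {a} {b} eq with a ≟ᶠ b
    ... | yes a≡b = a≡b

    ∈⇒∈ᵇ : {a : Fin n} {xs : List (Fin n)} → a ∈ xs → (a ∈ᵇ xs) ≡ true
    ∈⇒∈ᵇ {a} (here refl) rewrite ==-refl a = refl
    ∈⇒∈ᵇ {a} {b ∷ _} (there a∈xs) rewrite ∈⇒∈ᵇ a∈xs = ∨-zeroʳ (a == b)

    ∉⇒∈ᵇ-false : {a : Fin n} {xs : List (Fin n)} → All (a ≢_) xs → (a ∈ᵇ xs) ≡ false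
    ∉⇒∈ᵇ-false []             = refl
    ∉⇒∈ᵇ-false (a≢b ∷ a∉xs) rewrite ==-≢ a≢b = ∉⇒∈ᵇ-false a∉xs

    ∑-if-== : (p : Fin n) (f : Fin n → ℕ) → ∑ (λ a → if a == p then f a else 0) ≡ f p
    ∑-if-== p f = trans (∑-supported p _ λ a a≢p → cong (λ b → if b then f a else 0) (==-≢ a≢p))
                        (cong (λ b → if b then f p else 0) (==-refl p))

    ∑-if-∈ᵇ : {xs : List (Fin n)} (f : Fin n → ℕ) → Unique xs → ∑ (λ a → if a ∈ᵇ xs then f a else 0) ≡ sum (map f xs)
    ∑-if-∈ᵇ f [] = ∑-zero {n}
    ∑-if-∈ᵇ {p ∷ xs} f (p∉xs ∷ xs!) = begin
      ∑ (λ a → if (a == p) ∨ (a ∈ᵇ xs) then f a else 0)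
        ≡⟨ ∑-cong split ⟩
      ∑ (λ a → (if a == p then f a else 0) + (if a ∈ᵇ xs then f a else 0))
        ≡⟨ ∑-distrib-+ (λ a → if a == p then f a else 0) (λ a → if a ∈ᵇ xs then f a else 0) ⟩
      ∑ (λ a → if a == p then f a else 0) + ∑ (λ a → if a ∈ᵇ xs then f a else 0)
        ≡⟨ cong₂ _+_ (∑-if-== p f) (∑-if-∈ᵇ f xs!) ⟩
      f p + sum (map f xs) ∎
      where
      open ≡-Reasoning
      split : ∀ a → (if (a == p) ∨ (a ∈ᵇ xs) then f a else 0)
                  ≡ (if a == p then f a else 0) + (if a ∈ᵇ xs then f a else 0)
      split a with a == p in a=p
      ... | false = refl
      ... | true rewrite ==⇒≡ a=p | ∉⇒∈ᵇ-false p∉xs = sym (+-identityʳ (f p))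

    sum-map-≤-∑ : {xs : List (Fin n)} (f : Fin n → ℕ) → Unique xs → sum (map f xs) ≤ ∑ f
    sum-map-≤-∑ {xs} f xs! = subst (_≤ ∑ f) (∑-if-∈ᵇ f xs!) (∑-mono-≤ λ a → if-≤ (a ∈ᵇ xs) (f a))

    ∑∑ : (Fin n → Fin n → ℕ) → ℕ
    ∑∑ h = ∑ (λ a → ∑ (h a))

    ∑∑-mono-≤ : {g h : Fin n → Fin n → ℕ} → (∀ a b → g a b ≤ h a b) → ∑∑ g ≤ ∑∑ h
    ∑∑-mono-≤ le = ∑-mono-≤ λ a → ∑-mono-≤ (le a)

    ∑∑-distrib-+ : (g h : Fin n → Fin n → ℕ) → ∑∑ (λ a b → g a b + h a b) ≡ ∑∑ g + ∑∑ h
    ∑∑-distrib-+ g h = trans (∑-cong λ a → ∑-distrib-+ (g a) (h a)) (∑-distrib-+ (λ a → ∑ (g a)) (λ a → ∑ (h a)))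

    ∑∑-if-== : (p q : Fin n) (h : Fin n → Fin n → ℕ) →
      ∑∑ (λ a b → if a == p then (if b == q then h a b else 0) else 0) ≡ h p q
    ∑∑-if-== p q h = trans (∑-cong λ a → trans (∑-if (a == p) (λ b → if b == q then h a b else 0))
                                                (cong (λ t → if a == p then t else 0) (∑-if-== q (h a))))
                           (∑-if-== p (λ a → h a q))

    sumPairs : (Fin n → Fin n → ℕ) → List (Fin n) → ℕ
    sumPairs h xs = sum (map (λ p → sum (map (h p) xs)) xs)

    ∑∑-if-∈ᵇ : {xs : List (Fin n)} (h : Fin n → Fin n → ℕ) → Unique xs →
      ∑∑ (λ a b → if a ∈ᵇ xs then (if b ∈ᵇ xs then h a b else 0) else 0) ≡ sumPairs h xs
    ∑∑-if-∈ᵇ {xs} h xs! = trans (∑-cong λ a → trans (∑-if (a ∈ᵇ xs) (λ b → if b ∈ᵇ xs then h a b else 0))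
                                                     (cong (λ t → if a ∈ᵇ xs then t else 0) (∑-if-∈ᵇ (h a) xs!)))
                                (∑-if-∈ᵇ (λ a → sum (map (h a) xs)) xs!)

    sumUnorderedPairs : (Fin n → Fin n → ℕ) → List (Fin n) → ℕ
    sumUnorderedPairs h []       = 0
    sumUnorderedPairs h (p ∷ xs) = sum (map (λ q → h p q + h q p) xs) + sumUnorderedPairs h xs

    sumUnorderedPairs≤sumPairs : (h : Fin n → Fin n → ℕ) (xs : List (Fin n)) → sumUnorderedPairs h xs ≤ sumPairs h xs
    sumUnorderedPairs≤sumPairs h []       = z≤n
    sumUnorderedPairs≤sumPairs h (p ∷ xs) = begin
      sum (map (λ q → h p q + h q p) xs) + sumUnorderedPairs h xs
        ≤⟨ +-monoʳ-≤ (sum (map (λ q → h p q + h q p) xs)) (sumUnorderedPairs≤sumPairs h xs) ⟩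
      sum (map (λ q → h p q + h q p) xs) + sumPairs h xs
        ≡⟨ cong (_+ sumPairs h xs) (sum-map-+ (h p) (λ q → h q p) xs) ⟩
      sum (map (h p) xs) + sum (map (λ q → h q p) xs) + sumPairs h xs
        ≡⟨ +-assoc (sum (map (h p) xs)) _ _ ⟩
      sum (map (h p) xs) + (sum (map (λ q → h q p) xs) + sumPairs h xs)
        ≡⟨ cong (sum (map (h p) xs) +_) (sym (sum-map-+ (λ q → h q p) (λ q → sum (map (h q) xs)) xs)) ⟩
      sum (map (h p) xs) + sum (map (λ q → sum (map (h q) (p ∷ xs))) xs)
        ≤⟨ m≤n+m _ (h p p) ⟩
      h p p + (sum (map (h p) xs) + sum (map (λ q → sum (map (h q) (p ∷ xs))) xs))
        ≡⟨ sym (+-assoc (h p p) _ _) ⟩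
      sumPairs h (p ∷ xs) ∎
      where open ≤-Reasoning

    ∑∑-pair-≤ : {p q : Fin n} (h : Fin n → Fin n → ℕ) → p ≢ q → h p q + h q p ≤ ∑∑ h
    ∑∑-pair-≤ {p} {q} h p≢q = begin
      h p q + h q p                ≡⟨ sym (trans (+-identityʳ _) (+-identityʳ _)) ⟩
      sumUnorderedPairs h ps       ≤⟨ sumUnorderedPairs≤sumPairs h ps ⟩
      sumPairs h ps                ≡⟨ sym (∑∑-if-∈ᵇ h ps!) ⟩
      ∑∑ (λ a b → if a ∈ᵇ ps then (if b ∈ᵇ ps then h a b else 0) else 0)
        ≤⟨ ∑∑-mono-≤ (λ a b → ≤-trans (if-≤ (a ∈ᵇ ps) _) (if-≤ (b ∈ᵇ ps) _)) ⟩
      ∑∑ h                         ∎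
      where
      open ≤-Reasoning
      ps = p ∷ q ∷ []
      ps! : Unique ps
      ps! = (p≢q ∷ []) ∷ [] ∷ []

module SubsetCounting where

  open ListSums
  open FinSums
  open import Data.Nat using (suc; _+_; _≤_; z≤n; s≤s)
  open import Data.Nat.Properties using (≤-refl; module ≤-Reasoning)
  open import Data.Bool using (if_then_else_; _∨_; not)
  open import Data.Fin.Subset using (Subset; ∣_∣; _∪_)
  open import Data.Vec using (lookup; tabulate) renaming ([] to []ᵥ; _∷_ to _∷ᵥ_)
  open import Data.Vec.Properties using (lookup-zipWith; lookup∘tabulate)
  open import Data.List using (List; []; _∷_; map; length)
  open import Data.List.Relation.Unary.All using (All; []; _∷_)
  open import Data.List.Relation.Unary.Unique.Propositional using (Unique)
  open import Data.Nat.ListAction using (sum)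
  open import Relation.Binary.PropositionalEquality

  ∣∣≡∑ : ∀ {n} (X : Subset n) → ∣ X ∣ ≡ ∑ (λ a → ind (lookup X a))
  ∣∣≡∑ []ᵥ            = refl
  ∣∣≡∑ (true ∷ᵥ X)  = trans (cong suc (∣∣≡∑ X)) (sym (∑-suc (λ a → ind (lookup (true ∷ᵥ X) a))))
  ∣∣≡∑ (false ∷ᵥ X) = trans (∣∣≡∑ X) (sym (∑-suc (λ a → ind (lookup (false ∷ᵥ X) a))))

  module _ {n : ℕ} where

    length≤∣∣ : (X : Subset n) {xs : List (Fin n)} → Unique xs → All (λ a → lookup X a ≡ true) xs → length xs ≤ ∣ X ∣
    length≤∣∣ X {xs} xs! xs⊆X = begin
      length xs                              ≡⟨ sym (all-ones xs⊆X) ⟩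
      sum (map (λ a → ind (lookup X a)) xs)  ≤⟨ sum-map-≤-∑ _ xs! ⟩
      ∑ (λ a → ind (lookup X a))             ≡⟨ sym (∣∣≡∑ X) ⟩
      ∣ X ∣                                  ∎
      where
      open ≤-Reasoning
      all-ones : ∀ {ys} → All (λ a → lookup X a ≡ true) ys → sum (map (λ a → ind (lookup X a)) ys) ≡ length ys
      all-ones []            = refl
      all-ones (a∈X ∷ ys⊆X) rewrite a∈X = cong suc (all-ones ys⊆X)

    ∣p∪q∣≤∣p∣+∣q∣ : (X Y : Subset n) → ∣ X ∪ Y ∣ ≤ ∣ X ∣ + ∣ Y ∣
    ∣p∪q∣≤∣p∣+∣q∣ X Y = begin
      ∣ X ∪ Y ∣                                         ≡⟨ ∣∣≡∑ (X ∪ Y) ⟩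
      ∑ (λ a → ind (lookup (X ∪ Y) a))                  ≤⟨ ∑-mono-≤ ind-∪ ⟩
      ∑ (λ a → ind (lookup X a) + ind (lookup Y a))     ≡⟨ ∑-distrib-+ (λ a → ind (lookup X a)) _ ⟩
      ∑ (λ a → ind (lookup X a)) + ∑ (λ a → ind (lookup Y a))
                                                        ≡⟨ sym (cong₂ _+_ (∣∣≡∑ X) (∣∣≡∑ Y)) ⟩
      ∣ X ∣ + ∣ Y ∣                                     ∎
      where
      open ≤-Reasoning
      ind-∨ : ∀ b c → ind (b ∨ c) ≤ ind b + ind c
      ind-∨ true  c = s≤s z≤n
      ind-∨ false c = ≤-refl
      ind-∪ : ∀ a → ind (lookup (X ∪ Y) a) ≤ ind (lookup X a) + ind (lookup Y a)
      ind-∪ a rewrite lookup-zipWith _∨_ a X Y = ind-∨ (lookup X a) (lookup Y a)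

    adjoin : Subset n → List (Fin n) → Subset n
    adjoin X xs = tabulate (λ a → lookup X a ∨ a ∈ᵇ xs)

    lookup-adjoin : ∀ X xs a → lookup (adjoin X xs) a ≡ lookup X a ∨ a ∈ᵇ xs
    lookup-adjoin X xs = lookup∘tabulate (λ a → lookup X a ∨ a ∈ᵇ xs)

    ∣adjoin∣≤ : (X : Subset n) {xs : List (Fin n)} → Unique xs →
      ∣ adjoin X xs ∣ ≤ ∣ X ∣ + sum (map (λ a → ind (not (lookup X a))) xs)
    ∣adjoin∣≤ X {xs} xs! = begin
      ∣ adjoin X xs ∣                                   ≡⟨ ∣∣≡∑ (adjoin X xs) ⟩
      ∑ (λ a → ind (lookup (adjoin X xs) a))            ≤⟨ ∑-mono-≤ pointwise ⟩
      ∑ (λ a → ind (lookup X a) + missing a)            ≡⟨ ∑-distrib-+ (λ a → ind (lookup X a)) missing ⟩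
      ∑ (λ a → ind (lookup X a)) + ∑ missing            ≡⟨ cong₂ _+_ (sym (∣∣≡∑ X)) (∑-if-∈ᵇ _ xs!) ⟩
      ∣ X ∣ + sum (map (λ a → ind (not (lookup X a))) xs) ∎
      where
      open ≤-Reasoning
      missing : Fin n → ℕ
      missing a = if a ∈ᵇ xs then ind (not (lookup X a)) else 0
      pointwise : ∀ a → ind (lookup (adjoin X xs) a) ≤ ind (lookup X a) + missing a
      pointwise a rewrite lookup-adjoin X xs a with lookup X a | a ∈ᵇ xs
      ... | true  | _     = s≤s z≤n
      ... | false | true  = ≤-refl
      ... | false | false = z≤n

module IntegerBounds where

  open import Data.Nat as ℕ using ()
  open import Data.Fin using (Fin)
  open import Data.Fin.Subset using (∣_∣)
  open import Data.List using ([]; _∷_; map; length)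
  open import Data.Nat.ListAction using (sum)
  open import Data.Integer using (ℤ; +_; _+_; _-_; -_; _≤_; +≤+)
  open import Data.Integer.Properties using (+-monoˡ-≤; pos-+)
  open import Data.Integer.Tactic.RingSolver using (solve-∀)
  open import Relation.Binary.PropositionalEquality
  open import Function.Bundles using (mk⇔)

  +i≤+a-+b⇔ : ∀ i a b → (+ i ≤ + a - + b) ⇔ (i ℕ.+ b ℕ.≤ a)
  +i≤+a-+b⇔ i a b = mk⇔ to from
    where
    cancel : ∀ (p q : ℤ) → (p - q) + q ≡ p
    cancel = solve-∀
    cancel′ : ∀ (p q : ℤ) → (p + q) - q ≡ p
    cancel′ = solve-∀
    to : + i ≤ + a - + b → i ℕ.+ b ℕ.≤ a
    to le with +-monoˡ-≤ (+ b) le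
    ... | le′ rewrite cancel (+ a) (+ b) | sym (pos-+ i b) with le′
    ... | +≤+ i+b≤a = i+b≤a
    from : i ℕ.+ b ℕ.≤ a → + i ≤ + a - + b
    from i+b≤a with +-monoˡ-≤ (- (+ b)) (+≤+ i+b≤a)
    ... | le rewrite pos-+ i b = subst (_≤ + a - + b) (cancel′ (+ i) (+ b)) le

  sumℤ-map-val : ∀ {n} (u v : Fin n) Hs →
    sumℤ (map (val u v) Hs) ≡ + sum (map (λ H → 2 ℕ.* ∣ H ∣) Hs) - + sum (map (tH u v) Hs)
  sumℤ-map-val u v []       = refl
  sumℤ-map-val u v (H ∷ Hs) rewrite sumℤ-map-val u v Hs =
    trans (regroup (+ (2 ℕ.* ∣ H ∣)) (+ tH u v H) (+ C) (+ T)) (cong₂ _-_ (sym (pos-+ (2 ℕ.* ∣ H ∣) C)) (sym (pos-+ (tH u v H) T)))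
    where
    C = sum (map (λ H → 2 ℕ.* ∣ H ∣) Hs)
    T = sum (map (tH u v) Hs)
    regroup : ∀ (a b c d : ℤ) → (a - b) + (c - d) ≡ (a + c) - (b + d)
    regroup = solve-∀

  valFam≡ : ∀ {n} (u v : Fin n) Hs → valFam u v Hs
    ≡ + (sum (map (λ H → 2 ℕ.* ∣ H ∣) Hs) ℕ.+ 2) - + (sum (map (tH u v) Hs) ℕ.+ 2 ℕ.* length Hs)
  valFam≡ u v Hs rewrite sumℤ-map-val u v Hs =
    trans (shuffle (+ C) (+ T) (+ (2 ℕ.* length Hs)) (+ 2)) (cong₂ _-_ (sym (pos-+ C 2)) (sym (pos-+ T _)))
    where
    C = sum (map (λ H → 2 ℕ.* ∣ H ∣) Hs)
    T = sum (map (tH u v) Hs)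
    shuffle : ∀ (c t l k : ℤ) → (c - t) - (l - k) ≡ (c + k) - (t + l)
    shuffle = solve-∀

module Sparsity {n : ℕ} where

  open ListSums
  open FinSums
  open SubsetCounting
  open import Data.Nat using (_+_; _*_; _≤_; z≤n; s≤s; _<ᵇ_; _≤ᵇ_)
  open import Data.Nat.Properties
    using (+-cancelʳ-≤; +-identityʳ; 1+n≰n; <-asym; <ᵇ⇒<; <⇒<ᵇ; <⇒≱; m≤m+n; ≤-antisym; ≤-refl; ≤-trans; ≤ᵇ⇒≤; ≤⇒≤ᵇ; ≮⇒≥;
           module ≤-Reasoning)
  open import Data.Bool using (Bool; if_then_else_; _∧_; _∨_; not; T)
  open import Data.Bool.Properties using (∧-identityʳ; ∨-identityʳ; T-≡) renaming (_≟_ to _≟ᵇ_)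
  open import Function.Bundles using (Equivalence)
  open IntegerBounds
  import Data.Integer as ℤ
  open import Relation.Nullary using (yes; no)
  open import Data.Fin using (toℕ)
  open import Data.Fin.Properties using (toℕ-injective)
  open import Data.Fin.Subset using (Subset; ∣_∣; _∪_; _⊆_; ⁅_⁆; ⊤)
  import Data.Fin.Subset.Properties as Subset
  open import Data.Vec using (lookup)
  open import Data.Vec.Properties using ([]=⇒lookup; lookup⇒[]=; ≡-dec)
  open import Data.List using (List; []; _∷_; map; length)
  open import Data.List.Relation.Unary.All using ([]; _∷_)
  open import Data.List.Relation.Unary.AllPairs using ([]; _∷_)
  open import Data.Nat.ListAction using (sum)
  open import Data.Sum using (inj₁; inj₂)
  open import Data.Product using (_,_; proj₁; proj₂)
  open import Data.Empty using (⊥-elim)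
  open import Relation.Nullary using (¬_)
  open import Relation.Binary.PropositionalEquality
  open import Function using (_∘_)

  edgesIn : Adj n → (Fin n → Fin n → Bool) → ℕ
  edgesIn adj c = count2 (λ a b → isEdge adj a b ∧ c a b)

  isPair : Fin n → Fin n → Fin n → Fin n → Bool
  isPair p q a b = (a == p ∧ b == q) ∨ (a == q ∧ b == p)

  isPair⇒ : ∀ {p q a b} → isPair p q a b ≡ true → (a ≡ p × b ≡ q) ⊎ (a ≡ q × b ≡ p)
  isPair⇒ {p} {q} {a} {b} eq with a == p in a=p | b == q in b=q | a == q in a=q | b == p in b=p
  ... | true | true | _    | _    = inj₁ (==⇒≡ a=p , ==⇒≡ b=q)
  ... | _    | _    | true | true = inj₂ (==⇒≡ a=q , ==⇒≡ b=p)

  <ᵇ-flip : ∀ {i j} → i ≢ j → (j <ᵇ i) ≡ not (i <ᵇ j)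
  <ᵇ-flip {i} {j} i≢j with i <ᵇ j in i<ᵇj | j <ᵇ i in j<ᵇi
  ... | true  | false = refl
  ... | false | true  = refl
  ... | true  | true  = ⊥-elim (<-asym (<ᵇ⇒< i j (subst T (sym i<ᵇj) _)) (<ᵇ⇒< j i (subst T (sym j<ᵇi) _)))
  ... | false | false = ⊥-elim (i≢j (≤-antisym (≮⇒≥ (λ j<i → subst T j<ᵇi (<⇒<ᵇ j<i)))
                                              (≮⇒≥ (λ i<j → subst T i<ᵇj (<⇒<ᵇ i<j)))))

  toℕ<ᵇ-flip : ∀ {a b : Fin n} → a ≢ b → (toℕ b <ᵇ toℕ a) ≡ not (toℕ a <ᵇ toℕ b)
  toℕ<ᵇ-flip a≢b = <ᵇ-flip (a≢b ∘ toℕ-injective)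

  isEdge-both-orientations : {adj : Adj n} → IsSimple adj → ∀ {p q} → adj p q ≡ true → p ≢ q → (c : Bool) →
    ind (isEdge adj p q ∧ c) + ind (isEdge adj q p ∧ c) ≡ ind c
  isEdge-both-orientations {adj} simple {p} {q} pq p≢q c
    rewrite pq | trans (IsSimple.sym simple q p) pq | toℕ<ᵇ-flip p≢q = once (toℕ p <ᵇ toℕ q) c
    where
    once : ∀ l c → ind ((l ∧ true) ∧ c) + ind ((not l ∧ true) ∧ c) ≡ ind c
    once true  c = +-identityʳ (ind c)
    once false c = refl

  contract4-≡ : (adj : Adj n) {z p q a b : Fin n} → a ≢ z → b ≢ z → isPair p q a b ≡ false →
    contract4 adj z p q a b ≡ adj a b
  contract4-≡ adj {a = a} {b} a≢z b≢z ¬pq rewrite ==-≢ a≢z | ==-≢ b≢z | ¬pq | ∧-identityʳ (adj a b) = ∨-identityʳ (adj a b)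

  isEdge-contract4-≤ : (adj : Adj n) (z p q a b : Fin n) →
    ind (isEdge (contract4 adj z p q) a b) ≤ ind (isEdge adj a b) + ind ((toℕ a <ᵇ toℕ b) ∧ isPair p q a b)
  isEdge-contract4-≤ adj z p q a b = split (toℕ a <ᵇ toℕ b) (adj a b) _ (isPair p q a b)
    where
    split : ∀ l e nz pq → ind (l ∧ ((e ∧ nz) ∨ pq)) ≤ ind (l ∧ e) + ind (l ∧ pq)
    split false e     nz pq = z≤n
    split true  true  nz pq = ≤-trans (ind≤1 _) (m≤m+n 1 _)
    split true  false nz pq = ≤-refl

  ∑∑-isPair-≤1 : {p q : Fin n} → p ≢ q → ∑∑ (λ a b → ind ((toℕ a <ᵇ toℕ b) ∧ isPair p q a b)) ≤ 1
  ∑∑-isPair-≤1 {p} {q} p≢q = begin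
    ∑∑ (λ a b → ind ((toℕ a <ᵇ toℕ b) ∧ isPair p q a b))
      ≤⟨ ∑∑-mono-≤ (λ a b → split (toℕ a <ᵇ toℕ b) (a == p) (b == q) (a == q) (b == p)) ⟩
    ∑∑ (λ a b → at p q a b + at q p a b)
      ≡⟨ ∑∑-distrib-+ (at p q) (at q p) ⟩
    ∑∑ (at p q) + ∑∑ (at q p)
      ≡⟨ cong₂ _+_ (∑∑-if-== p q _) (∑∑-if-== q p _) ⟩
    ind (toℕ p <ᵇ toℕ q) + ind (toℕ q <ᵇ toℕ p)
      ≡⟨ cong (ind (toℕ p <ᵇ toℕ q) +_) (cong ind (toℕ<ᵇ-flip p≢q)) ⟩
    ind (toℕ p <ᵇ toℕ q) + ind (not (toℕ p <ᵇ toℕ q))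
      ≡⟨ one (toℕ p <ᵇ toℕ q) ⟩
    1 ∎
    where
    open ≤-Reasoning
    at : Fin n → Fin n → Fin n → Fin n → ℕ
    at p q a b = if a == p then (if b == q then ind (toℕ a <ᵇ toℕ b) else 0) else 0
    one : ∀ l → ind l + ind (not l) ≡ 1
    one true  = refl
    one false = refl
    split : ∀ l A B C D → ind (l ∧ ((A ∧ B) ∨ (C ∧ D)))
                          ≤ (if A then (if B then ind l else 0) else 0) + (if C then (if D then ind l else 0) else 0)
    split false A     B     C     D     = z≤n
    split true  true  true  C     D     = s≤s z≤n
    split true  true  false true  true  = ≤-refl
    split true  true  false true  false = z≤n
    split true  true  false false D     = z≤n
    split true  false B     true  true  = ≤-refl
    split true  false B     true  false = z≤n
    split true  false B     false D     = z≤n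

  module _ (u v : Fin n) where

    ∈⁅u⁆∪⁅v⁆ : ∀ {a} → lookup (⁅ u ⁆ ∪ ⁅ v ⁆) a ≡ true → a ≡ u ⊎ a ≡ v
    ∈⁅u⁆∪⁅v⁆ {a} a∈ with Subset.x∈p∪q⁻ ⁅ u ⁆ ⁅ v ⁆ (lookup⇒[]= a _ a∈)
    ... | inj₁ a∈⁅u⁆ = inj₁ (Subset.x∈⁅y⁆⇒x≡y u a∈⁅u⁆)
    ... | inj₂ a∈⁅v⁆ = inj₂ (Subset.x∈⁅y⁆⇒x≡y v a∈⁅v⁆)

    ≢⁅u⁆∪⁅v⁆ : ∀ {H : Subset n} {a} → lookup H a ≡ true → a ≢ u → a ≢ v → H ≢ ⁅ u ⁆ ∪ ⁅ v ⁆
    ≢⁅u⁆∪⁅v⁆ a∈H a≢u a≢v refl with ∈⁅u⁆∪⁅v⁆ a∈H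
    ... | inj₁ a≡u = a≢u a≡u
    ... | inj₂ a≡v = a≢v a≡v

    ∣⁅u⁆∪⁅v⁆∣≤2 : ∣ ⁅ u ⁆ ∪ ⁅ v ⁆ ∣ ≤ 2
    ∣⁅u⁆∪⁅v⁆∣≤2 = subst₂ (λ i j → ∣ ⁅ u ⁆ ∪ ⁅ v ⁆ ∣ ≤ i + j) (Subset.∣⁅x⁆∣≡1 u) (Subset.∣⁅x⁆∣≡1 v)
                         (∣p∪q∣≤∣p∣+∣q∣ ⁅ u ⁆ ⁅ v ⁆)

    u∈⁅u⁆∪⁅v⁆ : lookup (⁅ u ⁆ ∪ ⁅ v ⁆) u ≡ true
    u∈⁅u⁆∪⁅v⁆ = []=⇒lookup (Subset.p⊆p∪q ⁅ v ⁆ (Subset.x∈⁅x⁆ u))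

    v∈⁅u⁆∪⁅v⁆ : lookup (⁅ u ⁆ ∪ ⁅ v ⁆) v ≡ true
    v∈⁅u⁆∪⁅v⁆ = []=⇒lookup (Subset.q⊆p∪q ⁅ u ⁆ ⁅ v ⁆ (Subset.x∈⁅x⁆ v))

    tH-⁅u⁆∪⁅v⁆ : tH u v (⁅ u ⁆ ∪ ⁅ v ⁆) ≡ 4
    tH-⁅u⁆∪⁅v⁆ with ≡-dec _≟ᵇ_ (⁅ u ⁆ ∪ ⁅ v ⁆) (⁅ u ⁆ ∪ ⁅ v ⁆)
    ... | yes _ = refl
    ... | no ≢ = ⊥-elim (≢ refl)

    tH-≢⁅u⁆∪⁅v⁆ : {H : Subset n} → H ≢ ⁅ u ⁆ ∪ ⁅ v ⁆ → 2 ≤ ∣ H ∣ → tH u v H ≡ 2 + ind (∣ H ∣ ≤ᵇ 3)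
    tH-≢⁅u⁆∪⁅v⁆ {H} H≢ 2≤∣H∣ with ≡-dec _≟ᵇ_ H (⁅ u ⁆ ∪ ⁅ v ⁆)
    ... | yes H≡ = ⊥-elim (H≢ H≡)
    ... | no _ rewrite Equivalence.to T-≡ (≤⇒≤ᵇ 2≤∣H∣) with ∣ H ∣ ≤ᵇ 3
    ...   | true  = refl
    ...   | false = refl

    ≤ᵇ3-false : ∀ {k} → 4 ≤ k → (k ≤ᵇ 3) ≡ false
    ≤ᵇ3-false {k} 4≤k with k ≤ᵇ 3 in k≤ᵇ3
    ... | false = refl
    ... | true  = ⊥-elim (<⇒≱ (s≤s (≤ᵇ⇒≤ k 3 (subst T (sym k≤ᵇ3) _))) 4≤k)

    tH-large : {H : Subset n} → H ≢ ⁅ u ⁆ ∪ ⁅ v ⁆ → 4 ≤ ∣ H ∣ → tH u v H ≡ 2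
    tH-large H≢ 4≤∣H∣ rewrite tH-≢⁅u⁆∪⁅v⁆ H≢ (≤-trans (s≤s (s≤s z≤n)) 4≤∣H∣) | ≤ᵇ3-false 4≤∣H∣ = refl

    FamilyBound : Adj n → List (Subset n) → Set
    FamilyBound adj Hs =
      iFam adj Hs + (sum (map (tH u v) Hs) + 2 * length Hs) ≤ sum (map (λ H → 2 * ∣ H ∣) Hs) + 2

    module _ {W : Subset n} {adj : Adj n} where

      sparse-set : UVSparse W adj u v → (H : Subset n) → H ⊆ W → 2 ≤ ∣ H ∣ → iSet adj H + tH u v H ≤ 2 * ∣ H ∣
      sparse-set sparse H H⊆W 2≤∣H∣ = Equivalence.to (+i≤+a-+b⇔ _ _ _) (proj₁ sparse _ H⊆W 2≤∣H∣)

      sparse-family : UVSparse W adj u v → {Hs : List (Subset n)} → UVCompatible W u v Hs → FamilyBound adj Hs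
      sparse-family sparse {Hs} compatible =
        Equivalence.to (+i≤+a-+b⇔ _ _ _) (subst (_ ℤ.≤_) (valFam≡ u v Hs) (proj₂ sparse Hs compatible))

      uvSparse : (∀ H → H ⊆ W → 2 ≤ ∣ H ∣ → iSet adj H + tH u v H ≤ 2 * ∣ H ∣) →
                 (∀ Hs → UVCompatible W u v Hs → FamilyBound adj Hs) → UVSparse W adj u v
      uvSparse sets families =
        (λ H H⊆W 2≤∣H∣ → Equivalence.from (+i≤+a-+b⇔ _ _ _) (sets H H⊆W 2≤∣H∣)) ,
        (λ Hs compatible → subst (_ ℤ.≤_) (sym (valFam≡ u v Hs)) (Equivalence.from (+i≤+a-+b⇔ _ _ _) (families Hs compatible)))

    uv-nonadjacent : {adj : Adj n} → IsSimple adj → u ≢ v → UVSparse ⊤ adj u v → adj u v ≡ false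
    uv-nonadjacent {adj} simple u≢v sparse with adj u v in uv
    ... | false = refl
    ... | true  = ⊥-elim (1+n≰n (begin
      1                  ≡⟨ sym (edge-uv-counted) ⟩
      h u v + h v u      ≤⟨ ∑∑-pair-≤ h u≢v ⟩
      iSet adj X         ≤⟨ +-cancelʳ-≤ 4 (iSet adj X) 0 (subst₂ (λ t c → iSet adj X + t ≤ 2 * c) tH-⁅u⁆∪⁅v⁆ ∣X∣≡2
                                                                 (sparse-set sparse X (λ _ → Subset.∈⊤) 2≤∣X∣)) ⟩
      0                  ∎))
      where
      open ≤-Reasoning
      X = ⁅ u ⁆ ∪ ⁅ v ⁆
      h : Fin n → Fin n → ℕ
      h a b = ind (isEdge adj a b ∧ lookup X a ∧ lookup X b)
      edge-uv-counted : h u v + h v u ≡ 1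
      edge-uv-counted rewrite u∈⁅u⁆∪⁅v⁆ | v∈⁅u⁆∪⁅v⁆ = isEdge-both-orientations simple uv u≢v true
      2≤∣X∣ : 2 ≤ ∣ X ∣
      2≤∣X∣ = length≤∣∣ X ((u≢v ∷ []) ∷ [] ∷ []) (u∈⁅u⁆∪⁅v⁆ ∷ v∈⁅u⁆∪⁅v⁆ ∷ [])
      ∣X∣≡2 : ∣ X ∣ ≡ 2
      ∣X∣≡2 = ≤-antisym ∣⁅u⁆∪⁅v⁆∣≤2 2≤∣X∣

module Roles where

  open import Data.Nat using (zero; suc; _+_; _*_; _∸_; _≤_; _≤?_; z≤n; s≤s)
  import Data.Nat.Properties as ℕ
  open import Data.Bool using (Bool; true; false; if_then_else_)
  open import Data.Bool.Properties using () renaming (_≟_ to _≟ᵇ_)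
  open import Relation.Nullary.Decidable using (Dec; map′; ¬?; _×-dec_; _→-dec_; toWitness)
  open import Relation.Binary.Definitions using (DecidableEquality)
  open import Relation.Binary.PropositionalEquality using (refl; cong)
  open import Data.Product using (_,_)
  open ListSums using (ind)

  -- How a vertex a of Q meets the merged members M: a ∈ {u, v}; a ∉ ⋃M; a lies only in members of
  -- size 3, i.e. in triangles {u, v, a}; a lies in a member of size at least 4.  The credit of a role is
  -- what the vertex count of U needs from that vertex, and misses r s holds when no member can contain
  -- an edge between vertices of roles r and s.
  data Role : Set where
    uv outside triangle large : Role

  roleOf : (isUV inM : Bool) (multLarge : ℕ) → Role
  roleOf true  _     _       = uv
  roleOf false false _       = outside
  roleOf false true  zero    = triangle
  roleOf false true  (suc _) = large

  credit : Role → ℕ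
  credit uv       = 0
  credit outside  = 2
  credit triangle = 1
  credit large    = 0

  misses : Role → Role → Bool
  misses outside  _        = true
  misses _        outside  = true
  misses triangle triangle = true
  misses triangle large    = true
  misses large    triangle = true
  misses _        _        = false

  private
    code : Role → ℕ
    code uv       = 0
    code outside  = 1
    code triangle = 2
    code large    = 3

    code-injective : ∀ {r s} → code r ≡ code s → r ≡ s
    code-injective {uv}       {uv}       _ = refl
    code-injective {outside}  {outside}  _ = refl
    code-injective {triangle} {triangle} _ = refl
    code-injective {large}    {large}    _ = refl

  _≟ʳ_ : DecidableEquality Role
  r ≟ʳ s = map′ code-injective (cong code) (code r ℕ.≟ code s)

  ∀-role? : {P : Role → Set} → (∀ r → Dec (P r)) → Dec (∀ r → P r)
  ∀-role? P? = map′ (λ { (p₁ , p₂ , p₃ , p₄) → λ { uv → p₁ ; outside → p₂ ; triangle → p₃ ; large → p₄ } })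
                    (λ p → p uv , p outside , p triangle , p large)
                    (P? uv ×-dec P? outside ×-dec P? triangle ×-dec P? large)

  NotBothUV : Role → Role → Set
  NotBothUV r s = ¬ (r ≡ uv × s ≡ uv)

  -- Checked by evaluating all 4⁴ role assignments.
  credit-≤-misses : ∀ rx r₁ r₂ r₃ →
    rx ≢ outside → r₁ ≢ outside → (rx ≢ uv → r₁ ≢ uv → rx ≡ large × r₁ ≡ large) →
    NotBothUV rx r₁ → NotBothUV rx r₂ → NotBothUV rx r₃ → NotBothUV r₁ r₂ → NotBothUV r₁ r₃ → NotBothUV r₂ r₃ →
    credit rx + (credit r₁ + (credit r₂ + (credit r₃ + 0)))
      ≤ ind (misses rx r₂) + ind (misses rx r₃) + ind (misses r₁ r₂) + ind (misses r₁ r₃) + ind (misses r₂ r₃)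
  credit-≤-misses = toWitness {a? = ∀-role? λ rx → ∀-role? λ r₁ → ∀-role? λ r₂ → ∀-role? λ r₃ →
      ¬? (rx ≟ʳ outside) →-dec ¬? (r₁ ≟ʳ outside) →-dec (¬? (rx ≟ʳ uv) →-dec ¬? (r₁ ≟ʳ uv) →-dec (rx ≟ʳ large ×-dec r₁ ≟ʳ large)) →-dec
      notBothUV? rx r₁ →-dec notBothUV? rx r₂ →-dec notBothUV? rx r₃ →-dec
      notBothUV? r₁ r₂ →-dec notBothUV? r₁ r₃ →-dec notBothUV? r₂ r₃ →-dec
      (credit rx + (credit r₁ + (credit r₂ + (credit r₃ + 0)))
        ≤? ind (misses rx r₂) + ind (misses rx r₃) + ind (misses r₁ r₂) + ind (misses r₁ r₃) + ind (misses r₂ r₃))} _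
    where
    notBothUV? : ∀ r s → Dec (NotBothUV r s)
    notBothUV? r s = ¬? (r ≟ʳ uv ×-dec s ≟ʳ uv)

  ¬misses : ∀ r s → r ≢ outside → s ≢ outside → (r ≡ triangle → s ≡ uv) → (s ≡ triangle → r ≡ uv) → misses r s ≡ false
  ¬misses = toWitness {a? = ∀-role? λ r → ∀-role? λ s →
      ¬? (r ≟ʳ outside) →-dec ¬? (s ≟ʳ outside) →-dec (r ≟ʳ triangle →-dec s ≟ʳ uv) →-dec (s ≟ʳ triangle →-dec r ≟ʳ uv) →-dec
      (misses r s ≟ᵇ false)} _

  roleOf-outside : ∀ {b m k} → roleOf b m k ≡ outside → b ≡ false × m ≡ false
  roleOf-outside {false} {false} _ = refl , refl
  roleOf-outside {false} {true} {zero} ()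
  roleOf-outside {false} {true} {suc _} ()

  roleOf-triangle : ∀ {b m k} → roleOf b m k ≡ triangle → b ≡ false × k ≡ 0
  roleOf-triangle {false} {true} {zero} _ = refl , refl

  roleOf-uv : ∀ {b m k} → roleOf b m k ≡ uv → b ≡ true
  roleOf-uv {true} _ = refl
  roleOf-uv {false} {false} ()
  roleOf-uv {false} {true} {zero} ()
  roleOf-uv {false} {true} {suc _} ()

  roleOf-≢uv : ∀ {b m k} → roleOf b m k ≢ uv → b ≡ false
  roleOf-≢uv {true}  ≢uv with () ← ≢uv refl
  roleOf-≢uv {false} _ = refl

  roleOf-large : ∀ {b m k} → b ≡ false → m ≡ true → 1 ≤ k → roleOf b m k ≡ large
  roleOf-large {k = suc _} refl refl _ = refl

  credit-pays : ∀ b m (s k f : ℕ) → (m ≡ false → s + k ≡ 0) → (m ≡ true → 1 ≤ s + k) → f ≤ 1 →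
    (if b then 0 else s) + 2 * (if b then 0 else (if m then 0 else f))
      ≤ credit (roleOf b m k) + 2 * (if b then 0 else (s + k ∸ 1))
  credit-pays true  m     s k       f _    _   _   = z≤n
  credit-pays false false s k       f none _   f≤1
    rewrite ℕ.m+n≡0⇒m≡0 s (none refl) | ℕ.m+n≡0⇒n≡0 s (none refl) = ℕ.≤-trans (ℕ.*-monoʳ-≤ 2 f≤1) (ℕ.m≤m+n 2 0)
  credit-pays false true  zero    zero f _ some _ with () ← some refl
  credit-pays false true  (suc s) zero f _ _    _ = s≤s (ℕ.m≤m+n (s + 0) _)
  credit-pays false true  s (suc k) f _    _   _
    rewrite ℕ.+-suc s k | ℕ.+-identityʳ s = ℕ.≤-trans (ℕ.m≤m+n s k) (ℕ.m≤m+n (s + k) _)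

module Arithmetic where

  open import Data.Nat using (_+_; _*_; _≤_)
  open import Data.Nat.Properties using (+-assoc; +-cancelʳ-≤; +-mono-≤; +-monoʳ-≤; +-monoˡ-≤; *-monoʳ-≤; module ≤-Reasoning)
  open import Data.Nat.Tactic.RingSolver using (solve-∀)
  open import Relation.Binary.PropositionalEquality using (trans; sym)

  set-arithmetic : ∀ i′ i t h h⁺ a₂ a₃ w → i′ + (3 + (a₂ + a₃ + a₂ + a₃ + w)) ≤ i + 1 → i + 2 ≤ 2 * h⁺ →
    h⁺ ≤ h + (1 + (a₂ + a₃)) → t ≤ 2 + w → i′ + t ≤ 2 * h
  set-arithmetic i′ i t h h⁺ a₂ a₃ w merged sparse⁺ size⁺ t≤ =
    +-cancelʳ-≤ (3 + 2 * a₂ + 2 * a₃) (i′ + t) (2 * h) (begin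
      i′ + t + (3 + 2 * a₂ + 2 * a₃)                ≤⟨ +-monoˡ-≤ _ (+-monoʳ-≤ i′ t≤) ⟩
      i′ + (2 + w) + (3 + 2 * a₂ + 2 * a₃)          ≡⟨ shift₁ i′ w a₂ a₃ ⟩
      i′ + (3 + (a₂ + a₃ + a₂ + a₃ + w)) + 2        ≤⟨ +-monoˡ-≤ 2 merged ⟩
      i + 1 + 2                                     ≡⟨ trans (+-assoc i 1 2) (sym (+-assoc i 2 1)) ⟩
      i + 2 + 1                                     ≤⟨ +-monoˡ-≤ 1 sparse⁺ ⟩
      2 * h⁺ + 1                                    ≤⟨ +-monoˡ-≤ 1 (*-monoʳ-≤ 2 size⁺) ⟩
      2 * (h + (1 + (a₂ + a₃))) + 1                 ≡⟨ shift₂ h a₂ a₃ ⟩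
      2 * h + (3 + 2 * a₂ + 2 * a₃)                 ∎)
    where
    open ≤-Reasoning
    shift₁ : ∀ i′ w a₂ a₃ → i′ + (2 + w) + (3 + 2 * a₂ + 2 * a₃) ≡ i′ + (3 + (a₂ + a₃ + a₂ + a₃ + w)) + 2
    shift₁ = solve-∀
    shift₂ : ∀ h a₂ a₃ → 2 * (h + (1 + (a₂ + a₃))) + 1 ≡ 2 * h + (3 + 2 * a₂ + 2 * a₃)
    shift₂ = solve-∀

  family-arithmetic : ∀ i′ iF m tR cR lR lM sU σs σH σf s₃ →
    i′ + (3 + m) ≤ iF + 1 →
    iF + ((2 + tR) + 2 * (1 + lR)) ≤ (2 * sU + cR) + 2 →
    sU + 2 * lM + σs ≤ σH + σf + 2 →
    s₃ + 2 * σf ≤ m + 2 * σs + 2 →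
    i′ + (((2 * lM + s₃) + tR) + 2 * (lM + lR)) ≤ (2 * σH + cR) + 2
  family-arithmetic i′ iF m tR cR lR lM sU σs σH σf s₃ E S V K =
    +-cancelʳ-≤ extra _ _ (begin
      i′ + (((2 * lM + s₃) + tR) + 2 * (lM + lR)) + extra
        ≡⟨ lhs i′ iF m tR lR lM sU σs σf s₃ ⟩
      (i′ + (3 + m)) + (iF + ((2 + tR) + 2 * (1 + lR))) + 2 * (sU + 2 * lM + σs) + (s₃ + 2 * σf)
        ≤⟨ +-mono-≤ (+-mono-≤ (+-mono-≤ E S) (*-monoʳ-≤ 2 V)) K ⟩
      (iF + 1) + ((2 * sU + cR) + 2) + 2 * (σH + σf + 2) + (m + 2 * σs + 2)
        ≡⟨ rhs iF m cR sU σs σH σf ⟩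
      (2 * σH + cR) + 2 + extra ∎)
    where
    open ≤-Reasoning
    extra = 7 + m + iF + 2 * sU + 2 * σs + 2 * σf
    lhs : ∀ i′ iF m tR lR lM sU σs σf s₃ →
      i′ + (((2 * lM + s₃) + tR) + 2 * (lM + lR)) + (7 + m + iF + 2 * sU + 2 * σs + 2 * σf)
      ≡ (i′ + (3 + m)) + (iF + ((2 + tR) + 2 * (1 + lR))) + 2 * (sU + 2 * lM + σs) + (s₃ + 2 * σf)
    lhs = solve-∀
    rhs : ∀ iF m cR sU σs σH σf →
      (iF + 1) + ((2 * sU + cR) + 2) + 2 * (σH + σf + 2) + (m + 2 * σs + 2)
      ≡ (2 * σH + cR) + 2 + (7 + m + iF + 2 * sU + 2 * σs + 2 * σf)
    rhs = solve-∀

module Contraction {n : ℕ} (adj : Adj n) (simple : IsSimple adj) (u v z x v₁ v₂ v₃ : Fin n)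
  (sparse : UVSparse ⊤ adj u v) (u≢v : u ≢ v) (z≢u : z ≢ u) (z≢v : z ≢ v) (x≢z : x ≢ z) (x≢v₁ : x ≢ v₁)
  (zv₁ : adj z v₁ ≡ true) (zv₂ : adj z v₂ ≡ true) (zv₃ : adj z v₃ ≡ true)
  (xv₂ : adj x v₂ ≡ true) (xv₃ : adj x v₃ ≡ true)
  (v₁v₂ : adj v₁ v₂ ≡ true) (v₁v₃ : adj v₁ v₃ ≡ true) (v₂v₃ : adj v₂ v₃ ≡ true)
  (xv₁≢uv : ¬ ((v₁ ≡ u × x ≡ v) ⊎ (v₁ ≡ v × x ≡ u)))
  where

  open ListSums
  open FinSums
  open SubsetCounting
  open Sparsity {n}
  open Roles
  open Arithmetic
  open import Data.Nat.Tactic.RingSolver using (solve-∀)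
  open import Data.Nat using (suc; _+_; _*_; _≤_; _∸_; z≤n; s≤s; _<ᵇ_; _≤ᵇ_)
  open import Data.Nat.Properties
    using (*-identityˡ; *-monoʳ-≤; *-zeroˡ; +-assoc; +-cancelʳ-≤; +-comm; +-identityʳ; +-mono-≤; +-monoʳ-≤; +-monoˡ-≤;
           <⇒≱; m+[n∸m]≡n; m≤m+n; n≤1+n; ≤-reflexive; ≤-trans; module ≤-Reasoning)
  open import Data.Bool using (Bool; if_then_else_; _∧_; _∨_; not; T)
  open import Data.Bool.Properties using (∧-zeroʳ; ∧-identityʳ; ∨-identityʳ; ∨-zeroʳ; ∧-comm; T-≡)
  open import Function.Bundles using (Equivalence)
  open import Data.Fin using (toℕ)
  open import Data.Fin.Subset using (Subset; ∣_∣; _⊆_; _∪_) renaming (_∈_ to _∈ₛ_)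
  import Data.Fin.Subset.Properties as Subset
  open import Data.Vec using (lookup; tabulate)
  open import Data.Vec.Properties using ([]=⇒lookup; lookup⇒[]=; lookup∘tabulate)
  open import Data.List using (List; []; _∷_; map; length; filterᵇ)
  open import Data.List.Membership.Propositional using (_∈_)
  open import Data.List.Membership.Propositional.Properties using (∈-filter⁺; ∈-filter⁻)
  open import Data.List.Relation.Unary.Any using (here; there)
  open import Data.List.Relation.Unary.All using (All; []; _∷_)
  import Data.List.Relation.Unary.All as All
  import Data.List.Relation.Unary.All.Properties as All
  open import Data.List.Relation.Unary.AllPairs using ([]; _∷_)
  open import Data.List.Relation.Unary.Unique.Propositional using (Unique)
  import Data.List.Relation.Unary.Unique.Propositional.Properties as Unique
  open import Data.Nat.ListAction using (sum)
  open import Data.Bool.ListAction using (any)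
  open import Relation.Nullary.Decidable using (T?)
  open import Data.Sum using (inj₁; inj₂)
  open import Data.Product using (_,_; proj₁; proj₂; ∃-syntax)
  open import Data.Empty using (⊥-elim)
  open import Relation.Binary.PropositionalEquality
  open import Function using (_∘_)

  G′ : Adj n
  G′ = contract4 adj z x v₁

  W : Subset n
  W = ∁ ⁅ z ⁆

  adjacent⇒≢ : ∀ {a b} → adj a b ≡ true → a ≢ b
  adjacent⇒≢ {a} ab refl with () ← trans (sym ab) (IsSimple.irrefl simple a)

  K₅ : List (Fin n)
  K₅ = z ∷ x ∷ v₁ ∷ v₂ ∷ v₃ ∷ []

  K₅-unique : Unique K₅
  K₅-unique = (x≢z ∘ sym ∷ adjacent⇒≢ zv₁ ∷ adjacent⇒≢ zv₂ ∷ adjacent⇒≢ zv₃ ∷ [])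
            ∷ (x≢v₁ ∷ adjacent⇒≢ xv₂ ∷ adjacent⇒≢ xv₃ ∷ [])
            ∷ (adjacent⇒≢ v₁v₂ ∷ adjacent⇒≢ v₁v₃ ∷ [])
            ∷ (adjacent⇒≢ v₂v₃ ∷ [])
            ∷ []
            ∷ []

  Cover : Set
  Cover = Fin n → Fin n → Bool

  Symmetric : Cover → Set
  Symmetric c = ∀ a b → c a b ≡ c b a

  AvoidsZ : Cover → Set
  AvoidsZ c = ∀ a b → c a b ≡ true → a ≢ z × b ≢ z

  edgesIn-G′-≤ : (c : Cover) → Symmetric c → AvoidsZ c → c x v₁ ≡ false → edgesIn G′ c ≤ edgesIn adj c
  edgesIn-G′-≤ c symm avoids ¬xv₁ = ∑∑-mono-≤ pointwise
    where
    pointwise : ∀ a b → ind (isEdge G′ a b ∧ c a b) ≤ ind (isEdge adj a b ∧ c a b)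
    pointwise a b with c a b in ab
    ... | false rewrite ∧-zeroʳ (isEdge G′ a b) = z≤n
    ... | true  = ≤-reflexive (cong (λ t → ind (((toℕ a <ᵇ toℕ b) ∧ t) ∧ true))
                    (contract4-≡ adj (proj₁ (avoids a b ab)) (proj₂ (avoids a b ab)) not-xv₁))
      where
      not-xv₁ : isPair x v₁ a b ≡ false
      not-xv₁ with isPair x v₁ a b in p
      ... | false = refl
      ... | true with isPair⇒ {x} {v₁} {a} {b} p
      ...   | inj₁ (a≡x , b≡v₁) with () ← trans (sym ab) (trans (cong₂ c a≡x b≡v₁) ¬xv₁)
      ...   | inj₂ (a≡v₁ , b≡x) with () ← trans (sym ab) (trans (cong₂ c a≡v₁ b≡x) (trans (symm v₁ x) ¬xv₁))

  missed : Cover → ℕ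
  missed c = ind (not (c x v₂)) + ind (not (c x v₃)) + ind (not (c v₁ v₂)) + ind (not (c v₁ v₃)) + ind (not (c v₂ v₃))

  module Merge (cO cN : Cover) (symm : Symmetric cO) (avoids : AvoidsZ cO)
    (O⇒N : ∀ a b → cO a b ≡ true → cN a b ≡ true)
    (N⊇K₅ : ∀ a b → (a ∈ᵇ K₅) ≡ true → (b ∈ᵇ K₅) ≡ true → cN a b ≡ true)
    where

    uncovered : Fin n → Fin n → ℕ
    uncovered a b = ind (isEdge adj a b ∧ not (cO a b))

    uncoveredIn-K₅ : Fin n → Fin n → ℕ
    uncoveredIn-K₅ a b = if a ∈ᵇ K₅ then (if b ∈ᵇ K₅ then uncovered a b else 0) else 0

    newEdge : Fin n → Fin n → ℕ
    newEdge a b = ind ((toℕ a <ᵇ toℕ b) ∧ isPair x v₁ a b)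

    uncovered-edge : ∀ {p q} → adj p q ≡ true → uncovered p q + uncovered q p ≡ ind (not (cO p q))
    uncovered-edge {p} {q} pq rewrite symm q p = isEdge-both-orientations simple pq (adjacent⇒≢ pq) (not (cO p q))

    z-uncoverable : ∀ w → cO z w ≡ false
    z-uncoverable w with cO z w in c
    ... | false = refl
    ... | true  = ⊥-elim (proj₁ (avoids z w c) refl)

    z-uncovered : ∀ {w} → adj z w ≡ true → 1 ≤ uncovered z w + uncovered w z
    z-uncovered {w} zw = ≤-reflexive (sym (trans (uncovered-edge zw) (cong (ind ∘ not) (z-uncoverable w))))

    missed≤uncovered-K₅ : 3 + missed cO ≤ sumUnorderedPairs uncovered K₅
    missed≤uncovered-K₅ = begin
      3 + missed cO
        ≡⟨ arrange (ind (not (cO x v₂))) (ind (not (cO x v₃))) (ind (not (cO v₁ v₂)))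
                   (ind (not (cO v₁ v₃))) (ind (not (cO v₂ v₃))) ⟩
      (0 + (1 + (1 + (1 + 0)))) + ((0 + (m x v₂ + (m x v₃ + 0))) + ((m v₁ v₂ + (m v₁ v₃ + 0)) + ((m v₂ v₃ + 0) + 0)))
        -- the ten unordered pairs of K₅ in the order zx, zv₁, zv₂, zv₃, xv₁, xv₂, xv₃, v₁v₂, v₁v₃, v₂v₃
        ≤⟨ +-mono-≤ (+-mono-≤ (z≤n {pair z x}) (+-mono-≤ (z-uncovered zv₁) (+-mono-≤ (z-uncovered zv₂)
                         (+-mono-≤ (z-uncovered zv₃) (z≤n {0})))))
           (+-mono-≤ (+-mono-≤ (z≤n {pair x v₁}) (+-mono-≤ (edge xv₂) (+-mono-≤ (edge xv₃) (z≤n {0}))))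
           (+-mono-≤ (+-mono-≤ (edge v₁v₂) (+-mono-≤ (edge v₁v₃) (z≤n {0})))
           (+-mono-≤ (+-mono-≤ (edge v₂v₃) (z≤n {0})) (z≤n {0})))) ⟩
      sumUnorderedPairs uncovered K₅ ∎
      where
      open ≤-Reasoning
      m : Fin n → Fin n → ℕ
      m p q = ind (not (cO p q))
      pair : Fin n → Fin n → ℕ
      pair p q = uncovered p q + uncovered q p
      edge : ∀ {p q} → adj p q ≡ true → m p q ≤ pair p q
      edge pq = ≤-reflexive (sym (uncovered-edge pq))
      arrange : ∀ a b c d e → 3 + (a + b + c + d + e)
                            ≡ (0 + (1 + (1 + (1 + 0)))) + ((0 + (a + (b + 0))) + ((c + (d + 0)) + ((e + 0) + 0)))
      arrange = solve-∀

    covered⇒uncoveredIn-K₅≡0 : ∀ {a b} → cO a b ≡ true → uncoveredIn-K₅ a b ≡ 0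
    covered⇒uncoveredIn-K₅≡0 {a} {b} o rewrite o | ∧-zeroʳ (isEdge adj a b) with a ∈ᵇ K₅ | b ∈ᵇ K₅
    ... | true  | true  = refl
    ... | true  | false = refl
    ... | false | _     = refl

    pointwise : ∀ a b → ind (isEdge G′ a b ∧ cO a b) + uncoveredIn-K₅ a b ≤ ind (isEdge adj a b ∧ cN a b) + newEdge a b
    pointwise a b = by-cover (cO a b) refl
      where
      open ≤-Reasoning
      by-cover : ∀ c → cO a b ≡ c → ind (isEdge G′ a b ∧ cO a b) + uncoveredIn-K₅ a b ≤ ind (isEdge adj a b ∧ cN a b) + newEdge a b
      by-cover true o = begin
        ind (isEdge G′ a b ∧ cO a b) + uncoveredIn-K₅ a b
          ≡⟨ cong₂ _+_ (cong ind (trans (cong (isEdge G′ a b ∧_) o) (∧-identityʳ _))) (covered⇒uncoveredIn-K₅≡0 o) ⟩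
        ind (isEdge G′ a b) + 0
          ≡⟨ +-identityʳ _ ⟩
        ind (isEdge G′ a b)
          ≤⟨ isEdge-contract4-≤ adj z x v₁ a b ⟩
        ind (isEdge adj a b) + newEdge a b
          ≡⟨ cong (λ t → ind t + newEdge a b) (sym (trans (cong (isEdge adj a b ∧_) (O⇒N a b o)) (∧-identityʳ _))) ⟩
        ind (isEdge adj a b ∧ cN a b) + newEdge a b ∎
      by-cover false o rewrite o | ∧-zeroʳ (isEdge G′ a b) with a ∈ᵇ K₅ in a∈ | b ∈ᵇ K₅ in b∈
      ... | true  | true  rewrite N⊇K₅ a b a∈ b∈ = m≤m+n _ _
      ... | true  | false = z≤n
      ... | false | _     = z≤n

    -- An edge of G′ covered by cO is an edge of G covered by cN or the new edge xv₁, and the edges of G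
    -- inside K₅ that cO misses are covered by cN, so they are counted on the right as well.
    merge : edgesIn G′ cO + (3 + missed cO) ≤ edgesIn adj cN + 1
    merge = begin
      edgesIn G′ cO + (3 + missed cO)
        ≤⟨ +-monoʳ-≤ (edgesIn G′ cO) (≤-trans missed≤uncovered-K₅ (sumUnorderedPairs≤sumPairs uncovered K₅)) ⟩
      edgesIn G′ cO + sumPairs uncovered K₅
        ≡⟨ cong (edgesIn G′ cO +_) (sym (∑∑-if-∈ᵇ uncovered K₅-unique)) ⟩
      edgesIn G′ cO + ∑∑ uncoveredIn-K₅
        ≡⟨ sym (∑∑-distrib-+ (λ a b → ind (isEdge G′ a b ∧ cO a b)) uncoveredIn-K₅) ⟩
      ∑∑ (λ a b → ind (isEdge G′ a b ∧ cO a b) + uncoveredIn-K₅ a b)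
        ≤⟨ ∑∑-mono-≤ pointwise ⟩
      ∑∑ (λ a b → ind (isEdge adj a b ∧ cN a b) + newEdge a b)
        ≡⟨ ∑∑-distrib-+ (λ a b → ind (isEdge adj a b ∧ cN a b)) newEdge ⟩
      edgesIn adj cN + ∑∑ newEdge
        ≤⟨ +-monoʳ-≤ (edgesIn adj cN) (∑∑-isPair-≤1 x≢v₁) ⟩
      edgesIn adj cN + 1 ∎
      where open ≤-Reasoning

  ∧-true₁ : ∀ {p q} → (p ∧ q) ≡ true → p ≡ true
  ∧-true₁ {true} _ = refl

  ∧-true₂ : ∀ {p q} → (p ∧ q) ≡ true → q ≡ true
  ∧-true₂ {true} {true} _ = refl

  inside : Subset n → Cover
  inside H a b = lookup H a ∧ lookup H b

  inside-symmetric : ∀ H → Symmetric (inside H)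
  inside-symmetric H a b = ∧-comm (lookup H a) (lookup H b)

  ∈W⇒≢z : ∀ H → H ⊆ W → ∀ {a} → lookup H a ≡ true → a ≢ z
  ∈W⇒≢z H H⊆W {a} a∈H refl = Subset.x∈∁p⇒x∉p (H⊆W (lookup⇒[]= a _ a∈H)) (Subset.x∈⁅x⁆ z)

  z∉W : ∀ H → H ⊆ W → lookup H z ≡ false
  z∉W H H⊆W with lookup H z in z∈H
  ... | false = refl
  ... | true  = ⊥-elim (∈W⇒≢z H H⊆W z∈H refl)

  inside-avoids : ∀ H → H ⊆ W → AvoidsZ (inside H)
  inside-avoids H H⊆W a b ab = ∈W⇒≢z H H⊆W (∧-true₁ ab) , ∈W⇒≢z H H⊆W (∧-true₂ ab)

  module _ {X : Subset n} (K₅⊆X : ∀ {a} → (a ∈ᵇ K₅) ≡ true → lookup X a ≡ true) where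

    5≤∣∣ : 5 ≤ ∣ X ∣
    5≤∣∣ = length≤∣∣ X K₅-unique (All.tabulate (K₅⊆X ∘ ∈⇒∈ᵇ))

    tH-⊇K₅ : tH u v X ≡ 2
    tH-⊇K₅ = tH-large u v (≢⁅u⁆∪⁅v⁆ u v {X} (K₅⊆X {z} (∈⇒∈ᵇ {xs = K₅} (here refl))) z≢u z≢v) (≤-trans (n≤1+n 4) 5≤∣∣)

  inside-mono : ∀ H H′ → (∀ {a} → lookup H a ≡ true → lookup H′ a ≡ true) →
    ∀ a b → inside H a b ≡ true → inside H′ a b ≡ true
  inside-mono H H′ H⊆H′ a b ab with lookup H a in a∈H | lookup H b in b∈H
  ... | true | true rewrite H⊆H′ a∈H | H⊆H′ b∈H = refl

  xv₁∈⇒≢⁅u⁆∪⁅v⁆ : ∀ H → lookup H x ≡ true → lookup H v₁ ≡ true → H ≢ ⁅ u ⁆ ∪ ⁅ v ⁆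
  xv₁∈⇒≢⁅u⁆∪⁅v⁆ H x∈H v₁∈H refl with ∈⁅u⁆∪⁅v⁆ u v x∈H | ∈⁅u⁆∪⁅v⁆ u v v₁∈H
  ... | inj₁ x≡u | inj₁ v₁≡u = x≢v₁ (trans x≡u (sym v₁≡u))
  ... | inj₁ x≡u | inj₂ v₁≡v = xv₁≢uv (inj₂ (v₁≡v , x≡u))
  ... | inj₂ x≡v | inj₁ v₁≡u = xv₁≢uv (inj₁ (v₁≡u , x≡v))
  ... | inj₂ x≡v | inj₂ v₁≡v = x≢v₁ (trans x≡v (sym v₁≡v))

  x-v₁-v₂-v₃-unique : Unique (x ∷ v₁ ∷ v₂ ∷ v₃ ∷ [])
  x-v₁-v₂-v₃-unique = (x≢v₁ ∷ adjacent⇒≢ xv₂ ∷ adjacent⇒≢ xv₃ ∷ [])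
                    ∷ (adjacent⇒≢ v₁v₂ ∷ adjacent⇒≢ v₁v₃ ∷ []) ∷ (adjacent⇒≢ v₂v₃ ∷ []) ∷ [] ∷ []

  tH-∋xv₁ : ∀ H → lookup H x ≡ true → lookup H v₁ ≡ true → 2 ≤ ∣ H ∣ →
    tH u v H ≤ 2 + ind (not (lookup H v₂ ∧ lookup H v₃))
  tH-∋xv₁ H x∈H v₁∈H 2≤∣H∣ =
    subst (_≤ 2 + ind (not (lookup H v₂ ∧ lookup H v₃))) (sym (tH-≢⁅u⁆∪⁅v⁆ u v (xv₁∈⇒≢⁅u⁆∪⁅v⁆ H x∈H v₁∈H) 2≤∣H∣))
          (+-monoʳ-≤ 2 small⇒v₂v₃∉)
    where
    small⇒v₂v₃∉ : ind (∣ H ∣ ≤ᵇ 3) ≤ ind (not (lookup H v₂ ∧ lookup H v₃))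
    small⇒v₂v₃∉ with lookup H v₂ in v₂∈H | lookup H v₃ in v₃∈H
    ... | true  | true  = ≤-reflexive (cong ind (≤ᵇ3-false u v (length≤∣∣ H x-v₁-v₂-v₃-unique (x∈H ∷ v₁∈H ∷ v₂∈H ∷ v₃∈H ∷ []))))
    ... | true  | false = ind≤1 _
    ... | false | _     = ind≤1 _

  set-avoiding-xv₁ : ∀ H → H ⊆ W → 2 ≤ ∣ H ∣ → inside H x v₁ ≡ false → iSet G′ H + tH u v H ≤ 2 * ∣ H ∣
  set-avoiding-xv₁ H H⊆W 2≤∣H∣ ¬xv₁ =
    ≤-trans (+-monoˡ-≤ (tH u v H) (edgesIn-G′-≤ (inside H) (inside-symmetric H) (inside-avoids H H⊆W) ¬xv₁))
            (sparse-set u v sparse H (λ _ → Subset.∈⊤) 2≤∣H∣)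

  set-containing-xv₁ : ∀ H → H ⊆ W → 2 ≤ ∣ H ∣ → lookup H x ≡ true → lookup H v₁ ≡ true →
    iSet G′ H + tH u v H ≤ 2 * ∣ H ∣
  set-containing-xv₁ H H⊆W 2≤∣H∣ x∈H v₁∈H =
    set-arithmetic _ _ _ _ _ a₂ a₃ w merged sparse-H⁺ ∣H⁺∣≤ (tH-∋xv₁ H x∈H v₁∈H 2≤∣H∣)
    where
    H⁺ : Subset n
    H⁺ = adjoin H K₅
    K₅⊆H⁺ : ∀ {a} → (a ∈ᵇ K₅) ≡ true → lookup H⁺ a ≡ true
    K₅⊆H⁺ {a} a∈K₅ rewrite lookup-adjoin H K₅ a | a∈K₅ = ∨-zeroʳ (lookup H a)
    H⊆H⁺ : ∀ {a} → lookup H a ≡ true → lookup H⁺ a ≡ true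
    H⊆H⁺ {a} a∈H rewrite lookup-adjoin H K₅ a | a∈H = refl
    open Merge (inside H) (inside H⁺) (inside-symmetric H) (inside-avoids H H⊆W) (inside-mono H H⁺ H⊆H⁺)
               (λ a b a∈K₅ b∈K₅ → cong₂ _∧_ (K₅⊆H⁺ a∈K₅) (K₅⊆H⁺ b∈K₅))
    a₂ a₃ w : ℕ
    a₂ = ind (not (lookup H v₂))
    a₃ = ind (not (lookup H v₃))
    w  = ind (not (lookup H v₂ ∧ lookup H v₃))
    merged : iSet G′ H + (3 + (a₂ + a₃ + a₂ + a₃ + w)) ≤ iSet adj H⁺ + 1
    merged = subst (λ t → iSet G′ H + (3 + t) ≤ iSet adj H⁺ + 1) missed-inside merge
      where
      missed-inside : missed (inside H) ≡ a₂ + a₃ + a₂ + a₃ + w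
      missed-inside rewrite x∈H | v₁∈H = refl
    sparse-H⁺ : iSet adj H⁺ + 2 ≤ 2 * ∣ H⁺ ∣
    sparse-H⁺ = subst (λ t → iSet adj H⁺ + t ≤ 2 * ∣ H⁺ ∣) (tH-⊇K₅ {H⁺} K₅⊆H⁺)
                      (sparse-set u v sparse H⁺ (λ _ → Subset.∈⊤) (≤-trans (s≤s (s≤s z≤n)) (5≤∣∣ {H⁺} K₅⊆H⁺)))
    ∣H⁺∣≤ : ∣ H⁺ ∣ ≤ ∣ H ∣ + (1 + (a₂ + a₃))
    ∣H⁺∣≤ = subst (λ t → ∣ H⁺ ∣ ≤ ∣ H ∣ + t) missing (∣adjoin∣≤ H K₅-unique)
      where
      missing : sum (map (λ a → ind (not (lookup H a))) K₅) ≡ 1 + (a₂ + a₃)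
      missing rewrite z∉W H H⊆W | x∈H | v₁∈H = cong (λ t → 1 + (a₂ + t)) (+-identityʳ a₃)

  single-set : ∀ H → H ⊆ W → 2 ≤ ∣ H ∣ → iSet G′ H + tH u v H ≤ 2 * ∣ H ∣
  single-set H H⊆W 2≤∣H∣ with lookup H x in x∈H | lookup H v₁ in v₁∈H
  ... | true  | true  = set-containing-xv₁ H H⊆W 2≤∣H∣ x∈H v₁∈H
  ... | true  | false = set-avoiding-xv₁ H H⊆W 2≤∣H∣ (cong₂ _∧_ x∈H v₁∈H)
  ... | false | _     = set-avoiding-xv₁ H H⊆W 2≤∣H∣ (cong (_∧ lookup H v₁) x∈H)

  Member : Subset n → Set
  Member H = H ⊆ W × u ∈ₛ H × v ∈ₛ H × 3 ≤ ∣ H ∣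

  Member⇒⊤ : ∀ {H} → Member H → H ⊆ ⊤ × u ∈ₛ H × v ∈ₛ H × 3 ≤ ∣ H ∣
  Member⇒⊤ (_ , rest) = (λ _ → Subset.∈⊤) , rest

  -- iSet adj H and iFam adj Hs are edgesIn adj (inside H) and edgesIn adj (cover Hs) by definition.
  cover : List (Subset n) → Cover
  cover Hs a b = any (λ H → inside H a b) Hs

  cover-symmetric : ∀ Hs → Symmetric (cover Hs)
  cover-symmetric []       a b = refl
  cover-symmetric (H ∷ Hs) a b = cong₂ _∨_ (inside-symmetric H a b) (cover-symmetric Hs a b)

  cover⇒∃ : ∀ Hs {a b} → cover Hs a b ≡ true → ∃[ H ] (H ∈ Hs × lookup H a ≡ true × lookup H b ≡ true)
  cover⇒∃ Hs {a} {b} ab with any⁻ (λ H → inside H a b) Hs ab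
  ... | H , H∈Hs , a∧b = H , H∈Hs , ∧-true₁ a∧b , ∧-true₂ a∧b

  cover-avoids : ∀ {Hs} → All Member Hs → AvoidsZ (cover Hs)
  cover-avoids {Hs} members a b ab with cover⇒∃ Hs ab
  ... | H , H∈Hs , a∈H , b∈H = ∈W⇒≢z H H⊆W a∈H , ∈W⇒≢z H H⊆W b∈H
    where H⊆W = proj₁ (All.lookup members H∈Hs)

  compatible-in-⊤ : ∀ {Hs} → UVCompatible W u v Hs → UVCompatible ⊤ u v Hs
  compatible-in-⊤ (nonempty , Hs! , members) = nonempty , Hs! , All.map Member⇒⊤ members

  family-avoiding-xv₁ : ∀ Hs → UVCompatible W u v Hs → cover Hs x v₁ ≡ false → FamilyBound u v G′ Hs
  family-avoiding-xv₁ Hs compatible ¬xv₁ =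
    ≤-trans (+-monoˡ-≤ _ (edgesIn-G′-≤ (cover Hs) (cover-symmetric Hs) (cover-avoids (proj₂ (proj₂ compatible))) ¬xv₁))
            (sparse-family u v sparse (compatible-in-⊤ compatible))

  isUV : Fin n → Bool
  isUV a = a ∈ᵇ (u ∷ v ∷ [])

  isUV-u : isUV u ≡ true
  isUV-u = ∈⇒∈ᵇ {xs = u ∷ v ∷ []} (here refl)

  isUV-v : isUV v ≡ true
  isUV-v = ∈⇒∈ᵇ {xs = u ∷ v ∷ []} (there (here refl))

  isUV⇒ : ∀ {a} → isUV a ≡ true → a ≡ u ⊎ a ≡ v
  isUV⇒ {a} a∈uv with any⁻ (a ==_) (u ∷ v ∷ []) a∈uv
  ... | _ , here refl         , a=u = inj₁ (==⇒≡ a=u)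
  ... | _ , there (here refl) , a=v = inj₂ (==⇒≡ a=v)

  ¬isUV⇒ : ∀ {a} → isUV a ≡ false → a ≢ u × a ≢ v
  ¬isUV⇒ a∉uv = (λ { refl → true≢false (trans (sym isUV-u) a∉uv) }) , (λ { refl → true≢false (trans (sym isUV-v) a∉uv) })
    where
    true≢false : true ≢ false
    true≢false ()

  isUV-pair : ∀ {p q} → p ≢ q → isUV p ≡ true → isUV q ≡ true → (p ≡ u × q ≡ v) ⊎ (p ≡ v × q ≡ u)
  isUV-pair p≢q p∈ q∈ with isUV⇒ p∈ | isUV⇒ q∈
  ... | inj₁ p≡u | inj₁ q≡u = ⊥-elim (p≢q (trans p≡u (sym q≡u)))
  ... | inj₁ p≡u | inj₂ q≡v = inj₁ (p≡u , q≡v)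
  ... | inj₂ p≡v | inj₁ q≡u = inj₂ (p≡v , q≡u)
  ... | inj₂ p≡v | inj₂ q≡v = ⊥-elim (p≢q (trans p≡v (sym q≡v)))

  Member⇒≢⁅u⁆∪⁅v⁆ : ∀ {H} → Member H → H ≢ ⁅ u ⁆ ∪ ⁅ v ⁆
  Member⇒≢⁅u⁆∪⁅v⁆ (_ , _ , _ , 3≤∣H∣) refl = <⇒≱ (s≤s (∣⁅u⁆∪⁅v⁆∣≤2 u v)) 3≤∣H∣

  Member-∋⇒4≤∣∣ : ∀ {H p q} → Member H → lookup H p ≡ true → lookup H q ≡ true → p ≢ q →
    isUV p ≡ false → isUV q ≡ false → 4 ≤ ∣ H ∣
  Member-∋⇒4≤∣∣ {H} {p} {q} (_ , u∈H , v∈H , _) p∈H q∈H p≢q p∉uv q∉uv =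
    length≤∣∣ H ((u≢v ∷ (proj₁ p′ ∘ sym) ∷ (proj₁ q′ ∘ sym) ∷ []) ∷ ((proj₂ p′ ∘ sym) ∷ (proj₂ q′ ∘ sym) ∷ []) ∷ (p≢q ∷ []) ∷ [] ∷ [])
                 ([]=⇒lookup u∈H ∷ []=⇒lookup v∈H ∷ p∈H ∷ q∈H ∷ [])
    where
    p′ = ¬isUV⇒ p∉uv
    q′ = ¬isUV⇒ q∉uv

  module ThroughXv₁ (Hs : List (Subset n)) (Hs! : Unique Hs) (members : All Member Hs)
    {S : Subset n} (S∈Hs : S ∈ Hs) (x∈S : lookup S x ≡ true) (v₁∈S : lookup S v₁ ≡ true) where

    Q : List (Fin n)
    Q = x ∷ v₁ ∷ v₂ ∷ v₃ ∷ []

    meetsQ : Subset n → Bool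
    meetsQ H = any (λ a → lookup H a ∧ not (isUV a)) Q

    M R : List (Subset n)
    M = filterᵇ meetsQ Hs
    R = filterᵇ (not ∘ meetsQ) Hs

    inM : Fin n → Bool
    inM a = any (λ H → lookup H a) M

    U : Subset n
    U = tabulate (λ a → isUV a ∨ a ∈ᵇ K₅ ∨ inM a)

    F : List (Subset n)
    F = U ∷ R

    member : ∀ {H} → H ∈ Hs → Member H
    member = All.lookup members

    meetsQ⁺ : ∀ {H a} → a ∈ Q → lookup H a ≡ true → isUV a ≡ false → meetsQ H ≡ true
    meetsQ⁺ {H} {a} a∈Q a∈H a∉uv = any⁺ (λ b → lookup H b ∧ not (isUV b)) a∈Q (cong₂ _∧_ a∈H (cong not a∉uv))

    ∈M⁺ : ∀ {H} → H ∈ Hs → meetsQ H ≡ true → H ∈ M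
    ∈M⁺ H∈Hs meets = ∈-filter⁺ (T? ∘ meetsQ) H∈Hs (subst T (sym meets) _)

    ∈R⁺ : ∀ {H} → H ∈ Hs → meetsQ H ≡ false → H ∈ R
    ∈R⁺ H∈Hs ¬meets = ∈-filter⁺ (T? ∘ not ∘ meetsQ) H∈Hs (subst (T ∘ not) (sym ¬meets) _)

    ∈M⇒∈Hs : ∀ {H} → H ∈ M → H ∈ Hs
    ∈M⇒∈Hs H∈M = proj₁ (∈-filter⁻ (T? ∘ meetsQ) H∈M)

    inM⁺ : ∀ {H a} → H ∈ Hs → a ∈ Q → lookup H a ≡ true → isUV a ≡ false → inM a ≡ true
    inM⁺ {H} {a} H∈Hs a∈Q a∈H a∉uv = any⁺ (λ H → lookup H a) (∈M⁺ H∈Hs (meetsQ⁺ {H} a∈Q a∈H a∉uv)) a∈H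

    lookup-U : ∀ a → lookup U a ≡ (isUV a ∨ a ∈ᵇ K₅ ∨ inM a)
    lookup-U = lookup∘tabulate (λ a → isUV a ∨ a ∈ᵇ K₅ ∨ inM a)

    U-uv : ∀ {a} → isUV a ≡ true → lookup U a ≡ true
    U-uv {a} a∈uv rewrite lookup-U a | a∈uv = refl

    U-K₅ : ∀ {a} → (a ∈ᵇ K₅) ≡ true → lookup U a ≡ true
    U-K₅ {a} a∈K₅ rewrite lookup-U a | a∈K₅ = ∨-zeroʳ (isUV a)

    U-M : ∀ {H a} → H ∈ M → lookup H a ≡ true → lookup U a ≡ true
    U-M {H} {a} H∈M a∈H rewrite lookup-U a | any⁺ (λ H → lookup H a) H∈M a∈H =
      trans (cong (isUV a ∨_) (∨-zeroʳ (a ∈ᵇ K₅))) (∨-zeroʳ (isUV a))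

    F-compatible : UVCompatible ⊤ u v F
    F-compatible = s≤s z≤n , (All.tabulate U∉R ∷ Unique.filter⁺ (T? ∘ not ∘ meetsQ) Hs!)
                 , (((λ _ → Subset.∈⊤) , lookup⇒[]= u U (U-uv isUV-u) , lookup⇒[]= v U (U-uv isUV-v)
                      , ≤-trans (n≤1+n 3) (≤-trans (n≤1+n 4) (5≤∣∣ {U} U-K₅)))
                   ∷ All.map Member⇒⊤ (All.filter⁺ (T? ∘ not ∘ meetsQ) members))
      where
      U∉R : ∀ {H} → H ∈ R → U ≢ H
      U∉R H∈R refl with () ← trans (sym (U-K₅ {z} (∈⇒∈ᵇ {xs = K₅} (here refl))))
                                   (z∉W U (proj₁ (member (proj₁ (∈-filter⁻ (T? ∘ not ∘ meetsQ) H∈R)))))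

    cover-Hs⇒cover-F : ∀ a b → cover Hs a b ≡ true → cover F a b ≡ true
    cover-Hs⇒cover-F a b ab with cover⇒∃ Hs ab
    ... | H , H∈Hs , a∈H , b∈H with meetsQ H in meets
    ...   | true  rewrite U-M (∈M⁺ H∈Hs meets) a∈H | U-M (∈M⁺ H∈Hs meets) b∈H = refl
    ...   | false rewrite any⁺ (λ H → inside H a b) (∈R⁺ H∈Hs meets) (cong₂ _∧_ a∈H b∈H) =
      ∨-zeroʳ (inside U a b)

    open Merge (cover Hs) (cover F) (cover-symmetric Hs) (cover-avoids members) cover-Hs⇒cover-F
               (λ a b a∈K₅ b∈K₅ → cong (_∨ cover R a b) (cong₂ _∧_ (U-K₅ a∈K₅) (U-K₅ b∈K₅)))

    sparse-F : iFam adj F + ((2 + sum (map (tH u v) R)) + 2 * (1 + length R))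
               ≤ (2 * ∣ U ∣ + sum (map (λ H → 2 * ∣ H ∣) R)) + 2
    sparse-F = subst (λ t → iFam adj F + ((t + sum (map (tH u v) R)) + 2 * (1 + length R))
                            ≤ (2 * ∣ U ∣ + sum (map (λ H → 2 * ∣ H ∣) R)) + 2)
                     (tH-⊇K₅ {U} U-K₅) (sparse-family u v sparse F-compatible)

    -- Against ∑_{H ∈ M} ∣ H ∣, a vertex outside {u, v} in mult a members of M is counted mult a − 1 times
    -- too often in U (its surplus), and a vertex of K₅ outside ⋃M is new in U (fresh).
    mult surplus fresh : Fin n → ℕ
    mult a    = sum (map (λ H → ind (lookup H a)) M)
    surplus a = if isUV a then 0 else mult a ∸ 1
    fresh a   = if isUV a then 0 else (if inM a then 0 else ind (a ∈ᵇ K₅))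

    mult-uv : ∀ {a} → isUV a ≡ true → mult a ≡ length M
    mult-uv {a} a∈uv = trans (sum-map-cong M λ H∈M → cong ind (uv∈H (member (∈M⇒∈Hs H∈M))))
                             (trans (sum-map-const 1 M) (*-identityˡ (length M)))
      where
      uv∈H : ∀ {H} → Member H → lookup H a ≡ true
      uv∈H {H} (_ , u∈H , v∈H , _) with isUV⇒ {a} a∈uv
      ... | inj₁ a≡u = subst (λ b → lookup H b ≡ true) (sym a≡u) ([]=⇒lookup u∈H)
      ... | inj₂ a≡v = subst (λ b → lookup H b ≡ true) (sym a≡v) ([]=⇒lookup v∈H)

    vertex-pointwise : ∀ a → ind (lookup U a) + (if isUV a then length M else 0) + surplus a
                             ≤ mult a + fresh a + ind (isUV a)
    vertex-pointwise a rewrite lookup-U a with isUV a in a∈uv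
    ... | true = ≤-reflexive (trans (trans (+-identityʳ (suc (length M)))
                                           (trans (+-comm 1 (length M)) (cong (_+ 1) (sym (+-identityʳ (length M))))))
                                    (cong (λ t → t + 0 + 1) (sym (mult-uv a∈uv))))
    ... | false with inM a in a∈M
    ...   | true rewrite ∨-zeroʳ (a ∈ᵇ K₅) =
      ≤-reflexive (trans (m+[n∸m]≡n (sum-map-ind-any-true (λ H → lookup H a) M a∈M))
                         (sym (trans (+-identityʳ (mult a + 0)) (+-identityʳ (mult a)))))
    ...   | false rewrite ∨-identityʳ (a ∈ᵇ K₅) | sum-map-ind-any-false (λ H → lookup H a) M a∈M = ≤-reflexive (+-identityʳ _)

    vertex-count : ∣ U ∣ + 2 * length M + ∑ surplus ≤ sum (map ∣_∣ M) + ∑ fresh + 2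
    vertex-count = begin
      ∣ U ∣ + 2 * length M + ∑ surplus
        ≡⟨ cong (_+ ∑ surplus) (cong₂ _+_ (∣∣≡∑ U) (sym (∑-if-∈ᵇ (λ _ → length M) uv-unique))) ⟩
      ∑ (λ a → ind (lookup U a)) + ∑ (λ a → if isUV a then length M else 0) + ∑ surplus
        ≡⟨ sym (trans (∑-distrib-+ (λ a → ind (lookup U a) + (if isUV a then length M else 0)) surplus)
                      (cong (_+ ∑ surplus) (∑-distrib-+ (λ a → ind (lookup U a)) _))) ⟩
      ∑ (λ a → ind (lookup U a) + (if isUV a then length M else 0) + surplus a)
        ≤⟨ ∑-mono-≤ vertex-pointwise ⟩
      ∑ (λ a → mult a + fresh a + ind (isUV a))
        ≡⟨ trans (∑-distrib-+ (λ a → mult a + fresh a) (λ a → ind (isUV a))) (cong (_+ _) (∑-distrib-+ mult fresh)) ⟩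
      ∑ mult + ∑ fresh + ∑ (λ a → ind (isUV a))
        ≡⟨ cong₂ _+_ (cong (_+ ∑ fresh) ∑-mult) (∑-if-∈ᵇ (λ _ → 1) uv-unique) ⟩
      sum (map ∣_∣ M) + ∑ fresh + 2 ∎
      where
      open ≤-Reasoning
      uv-unique : Unique (u ∷ v ∷ [])
      uv-unique = (u≢v ∷ []) ∷ [] ∷ []
      ∑-mult : ∑ mult ≡ sum (map ∣_∣ M)
      ∑-mult = trans (∑-sum-map (λ H a → ind (lookup H a)) M) (sum-map-cong M λ {H} _ → sym (∣∣≡∑ H))

    small : Subset n → Bool
    small H = ∣ H ∣ ≤ᵇ 3

    multSmall multLarge triangles : Fin n → ℕ
    multSmall a = sum (map (λ H → ind (lookup H a ∧ small H)) M)
    multLarge a = sum (map (λ H → ind (lookup H a ∧ not (small H))) M)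
    triangles a = sum (map (λ H → ind ((lookup H a ∧ not (isUV a)) ∧ small H)) M)

    role : Fin n → Role
    role a = roleOf (isUV a) (inM a) (multLarge a)

    mult-split : ∀ a → mult a ≡ multSmall a + multLarge a
    mult-split a = trans (sum-map-cong M λ {H} _ → split (lookup H a) (small H))
                         (sum-map-+ (λ H → ind (lookup H a ∧ small H)) (λ H → ind (lookup H a ∧ not (small H))) M)
      where
      split : ∀ b c → ind b ≡ ind (b ∧ c) + ind (b ∧ not c)
      split false c     = refl
      split true  true  = refl
      split true  false = refl

    triangles≡ : ∀ a → triangles a ≡ (if isUV a then 0 else multSmall a)
    triangles≡ a with isUV a
    ... | true  = trans (sum-map-cong M λ {H} _ → cong (λ b → ind (b ∧ small H)) (∧-zeroʳ (lookup H a)))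
                        (trans (sum-map-const 0 M) (*-zeroˡ (length M)))
    ... | false = sum-map-cong M λ {H} _ → cong (λ b → ind (b ∧ small H)) (∧-identityʳ (lookup H a))

    credit-covers : ∀ a → triangles a + 2 * fresh a ≤ credit (role a) + 2 * surplus a
    credit-covers a = subst₂ (λ t s → t + 2 * fresh a ≤ credit (role a) + 2 * s)
      (sym (triangles≡ a)) (cong (λ m → if isUV a then 0 else m ∸ 1) (sym (mult-split a)))
      (credit-pays (isUV a) (inM a) (multSmall a) (multLarge a) (ind (a ∈ᵇ K₅))
        (λ a∉M → trans (sym (mult-split a)) (sum-map-ind-any-false (λ H → lookup H a) M a∉M))
        (λ a∈M → subst (1 ≤_) (mult-split a) (sum-map-ind-any-true (λ H → lookup H a) M a∈M))
        (ind≤1 _))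

    ∈M⇒meetsQ : ∀ {H} → H ∈ M → meetsQ H ≡ true
    ∈M⇒meetsQ H∈M = Equivalence.to T-≡ (proj₂ (∈-filter⁻ (T? ∘ meetsQ) {xs = Hs} H∈M))

    two-outside-uv⇒¬small : ∀ {H p q} → H ∈ Hs → lookup H p ≡ true → lookup H q ≡ true → p ≢ q →
      isUV p ≡ false → isUV q ≡ false → small H ≡ false
    two-outside-uv⇒¬small H∈Hs p∈H q∈H p≢q p∉uv q∉uv = ≤ᵇ3-false u v (Member-∋⇒4≤∣∣ (member H∈Hs) p∈H q∈H p≢q p∉uv q∉uv)

    large⇒multLarge : ∀ {H a} → H ∈ Hs → a ∈ Q → lookup H a ≡ true → small H ≡ false → isUV a ≡ false → 1 ≤ multLarge a
    large⇒multLarge {H} {a} H∈Hs a∈Q a∈H ¬small a∉uv =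
      ≤-trans (≤-reflexive (cong ind (sym (cong₂ _∧_ a∈H (cong not ¬small)))))
              (∈⇒≤sum-map (λ H → ind (lookup H a ∧ not (small H))) (∈M⁺ H∈Hs (meetsQ⁺ {H} a∈Q a∈H a∉uv)))

    role-≢outside : ∀ {H a} → H ∈ Hs → a ∈ Q → lookup H a ≡ true → role a ≢ outside
    role-≢outside {a = a} H∈Hs a∈Q a∈H out with roleOf-outside {isUV a} {inM a} {multLarge a} out
    ... | a∉uv , a∉M with () ← trans (sym (inM⁺ H∈Hs a∈Q a∈H a∉uv)) a∉M

    triangle-partner : ∀ {H p q} → H ∈ Hs → p ∈ Q → lookup H p ≡ true → lookup H q ≡ true → p ≢ q →
      role p ≡ triangle → role q ≡ uv
    triangle-partner {H} {p} {q} H∈Hs p∈Q p∈H q∈H p≢q tri with isUV q in q∈uv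
    ... | true  = refl
    ... | false with roleOf-triangle {isUV p} {inM p} {multLarge p} tri
    ...   | p∉uv , none with () ← subst (1 ≤_) none
              (large⇒multLarge H∈Hs p∈Q p∈H (two-outside-uv⇒¬small H∈Hs p∈H q∈H p≢q p∉uv q∈uv) p∉uv)

    both-large : role x ≢ uv → role v₁ ≢ uv → role x ≡ large × role v₁ ≡ large
    both-large x≢uv v₁≢uv = roleOf-large x∉uv (inM⁺ S∈Hs (here refl) x∈S x∉uv) (large⇒multLarge S∈Hs (here refl) x∈S ¬small x∉uv)
                          , roleOf-large v₁∉uv (inM⁺ S∈Hs (there (here refl)) v₁∈S v₁∉uv)
                                         (large⇒multLarge S∈Hs (there (here refl)) v₁∈S ¬small v₁∉uv)
      where
      x∉uv = roleOf-≢uv {isUV x} {inM x} {multLarge x} x≢uv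
      v₁∉uv = roleOf-≢uv {isUV v₁} {inM v₁} {multLarge v₁} v₁≢uv
      ¬small = two-outside-uv⇒¬small S∈Hs x∈S v₁∈S x≢v₁ x∉uv v₁∉uv

    misses-≤ : ∀ {p q} → p ∈ Q → q ∈ Q → p ≢ q → ind (misses (role p) (role q)) ≤ ind (not (cover Hs p q))
    misses-≤ {p} {q} p∈Q q∈Q p≢q with cover Hs p q in pq
    ... | false = ind≤1 _
    ... | true with cover⇒∃ Hs pq
    ...   | H , H∈Hs , p∈H , q∈H = ≤-reflexive (cong ind (¬misses (role p) (role q)
              (role-≢outside H∈Hs p∈Q p∈H) (role-≢outside H∈Hs q∈Q q∈H)
              (triangle-partner H∈Hs p∈Q p∈H q∈H p≢q) (triangle-partner H∈Hs q∈Q q∈H p∈H (p≢q ∘ sym))))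

    not-both-uv : ∀ {p q} → p ≢ q → ¬ ((p ≡ u × q ≡ v) ⊎ (p ≡ v × q ≡ u)) → NotBothUV (role p) (role q)
    not-both-uv {p} {q} p≢q ¬uv (p-uv , q-uv) =
      ¬uv (isUV-pair p≢q (roleOf-uv {isUV p} {inM p} {multLarge p} p-uv) (roleOf-uv {isUV q} {inM q} {multLarge q} q-uv))

    edge-not-uv : ∀ {p q} → adj p q ≡ true → ¬ ((p ≡ u × q ≡ v) ⊎ (p ≡ v × q ≡ u))
    edge-not-uv pq (inj₁ (refl , refl)) with () ← trans (sym pq) (uv-nonadjacent u v simple u≢v sparse)
    edge-not-uv pq (inj₂ (refl , refl)) with () ← trans (sym pq) (trans (IsSimple.sym simple v u) (uv-nonadjacent u v simple u≢v sparse))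

    credits-≤-missed : sum (map (λ a → credit (role a)) Q) ≤ missed (cover Hs)
    credits-≤-missed = ≤-trans
      (credit-≤-misses (role x) (role v₁) (role v₂) (role v₃)
        (role-≢outside S∈Hs x∈Q x∈S) (role-≢outside S∈Hs v₁∈Q v₁∈S) both-large
        (not-both-uv x≢v₁ λ { (inj₁ (x≡u , v₁≡v)) → xv₁≢uv (inj₂ (v₁≡v , x≡u))
                            ; (inj₂ (x≡v , v₁≡u)) → xv₁≢uv (inj₁ (v₁≡u , x≡v)) })
        (not-both-uv (adjacent⇒≢ xv₂) (edge-not-uv xv₂)) (not-both-uv (adjacent⇒≢ xv₃) (edge-not-uv xv₃))
        (not-both-uv (adjacent⇒≢ v₁v₂) (edge-not-uv v₁v₂)) (not-both-uv (adjacent⇒≢ v₁v₃) (edge-not-uv v₁v₃))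
        (not-both-uv (adjacent⇒≢ v₂v₃) (edge-not-uv v₂v₃)))
      (+-mono-≤ (+-mono-≤ (+-mono-≤ (+-mono-≤ (misses-≤ x∈Q v₂∈Q (adjacent⇒≢ xv₂)) (misses-≤ x∈Q v₃∈Q (adjacent⇒≢ xv₃)))
        (misses-≤ v₁∈Q v₂∈Q (adjacent⇒≢ v₁v₂))) (misses-≤ v₁∈Q v₃∈Q (adjacent⇒≢ v₁v₃))) (misses-≤ v₂∈Q v₃∈Q (adjacent⇒≢ v₂v₃)))
      where
      x∈Q : x ∈ Q
      x∈Q = here refl
      v₁∈Q : v₁ ∈ Q
      v₁∈Q = there (here refl)
      v₂∈Q : v₂ ∈ Q
      v₂∈Q = there (there (here refl))
      v₃∈Q : v₃ ∈ Q
      v₃∈Q = there (there (there (here refl)))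

    s₃ : ℕ
    s₃ = sum (map (λ H → ind (small H)) M)

    s₃≤triangles : s₃ ≤ sum (map triangles Q)
    s₃≤triangles = begin
      s₃
        ≤⟨ sum-map-mono-≤ M (λ {H} H∈M → ind-≤-sum-map-any (λ a → lookup H a ∧ not (isUV a)) Q (∈M⇒meetsQ H∈M) (small H)) ⟩
      sum (map (λ H → sum (map (λ a → ind ((lookup H a ∧ not (isUV a)) ∧ small H)) Q)) M)
        ≡⟨ sum-map-swap (λ (H : Subset n) (a : Fin n) → ind ((lookup H a ∧ not (isUV a)) ∧ small H)) M Q ⟩
      sum (map triangles Q) ∎
      where open ≤-Reasoning

    fresh≤1 : ∀ a → fresh a ≤ 1
    fresh≤1 a with isUV a | inM a
    ... | true  | _     = z≤n
    ... | false | true  = z≤n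
    ... | false | false = ind≤1 _

    ∑-fresh : ∑ fresh ≡ fresh z + sum (map fresh Q)
    ∑-fresh = trans (∑-cong only-K₅) (∑-if-∈ᵇ fresh K₅-unique)
      where
      only-K₅ : ∀ a → fresh a ≡ (if a ∈ᵇ K₅ then fresh a else 0)
      only-K₅ a with a ∈ᵇ K₅ | isUV a | inM a
      ... | true  | _     | _     = refl
      ... | false | true  | _     = refl
      ... | false | false | true  = refl
      ... | false | false | false = refl

    key : s₃ + 2 * ∑ fresh ≤ missed (cover Hs) + 2 * ∑ surplus + 2
    key = begin
      s₃ + 2 * ∑ fresh
        ≤⟨ +-mono-≤ s₃≤triangles (*-monoʳ-≤ 2 (≤-trans (≤-reflexive ∑-fresh) (+-monoˡ-≤ _ (fresh≤1 z)))) ⟩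
      sum (map triangles Q) + 2 * (1 + sum (map fresh Q))
        ≡⟨ regroup (sum (map triangles Q)) (sum (map fresh Q)) ⟩
      sum (map triangles Q) + 2 * sum (map fresh Q) + 2
        ≡⟨ cong (_+ 2) (sym (trans (sum-map-+ triangles (λ a → 2 * fresh a) Q)
                                   (cong (sum (map triangles Q) +_) (sum-map-* 2 fresh Q)))) ⟩
      sum (map (λ a → triangles a + 2 * fresh a) Q) + 2
        ≤⟨ +-monoˡ-≤ 2 (sum-map-mono-≤ Q λ {a} _ → credit-covers a) ⟩
      sum (map (λ a → credit (role a) + 2 * surplus a) Q) + 2
        ≡⟨ cong (_+ 2) (trans (sum-map-+ (λ a → credit (role a)) (λ a → 2 * surplus a) Q)
                              (cong (sum (map (λ a → credit (role a)) Q) +_) (sum-map-* 2 surplus Q))) ⟩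
      sum (map (λ a → credit (role a)) Q) + 2 * sum (map surplus Q) + 2
        ≤⟨ +-monoˡ-≤ 2 (+-mono-≤ credits-≤-missed (*-monoʳ-≤ 2 (sum-map-≤-∑ surplus x-v₁-v₂-v₃-unique))) ⟩
      missed (cover Hs) + 2 * ∑ surplus + 2 ∎
      where
      open ≤-Reasoning
      regroup : ∀ t f → t + 2 * (1 + f) ≡ t + 2 * f + 2
      regroup = solve-∀

    tH-M : sum (map (tH u v) M) ≡ 2 * length M + s₃
    tH-M = trans (sum-map-cong M λ H∈M → tH-≢⁅u⁆∪⁅v⁆ u v (Member⇒≢⁅u⁆∪⁅v⁆ (member-M H∈M)) (≤-trans (n≤1+n 2) (3≤ H∈M)))
                 (trans (sum-map-+ (λ _ → 2) (λ H → ind (small H)) M) (cong (_+ s₃) (sum-map-const 2 M)))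
      where
      member-M : ∀ {H} → H ∈ M → Member H
      member-M = member ∘ ∈M⇒∈Hs
      3≤ : ∀ {H} → H ∈ M → 3 ≤ ∣ H ∣
      3≤ H∈M = proj₂ (proj₂ (proj₂ (member-M H∈M)))

    length-Hs : length Hs ≡ length M + length R
    length-Hs = trans (length≡sum Hs) (trans (sum-map-filterᵇ (λ _ → 1) meetsQ Hs) (sym (cong₂ _+_ (length≡sum M) (length≡sum R))))
      where
      length≡sum : ∀ (xs : List (Subset n)) → length xs ≡ sum (map (λ _ → 1) xs)
      length≡sum xs = sym (trans (sum-map-const 1 xs) (*-identityˡ (length xs)))

    bound : FamilyBound u v G′ Hs
    bound = subst₂ (λ t c → iFam G′ Hs + t ≤ c + 2)
      (sym (cong₂ _+_ (trans (sum-map-filterᵇ (tH u v) meetsQ Hs) (cong (_+ sum (map (tH u v) R)) tH-M)) (cong (2 *_) length-Hs)))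
      (sym (trans (sum-map-filterᵇ (λ H → 2 * ∣ H ∣) meetsQ Hs) (cong (_+ sum (map (λ H → 2 * ∣ H ∣) R)) (sum-map-* 2 ∣_∣ M))))
      (family-arithmetic (iFam G′ Hs) (iFam adj F) (missed (cover Hs)) (sum (map (tH u v) R)) (sum (map (λ H → 2 * ∣ H ∣) R))
                  (length R) (length M) ∣ U ∣ (∑ surplus) (sum (map ∣_∣ M)) (∑ fresh) s₃ merge sparse-F vertex-count key)
      where

  families : ∀ Hs → UVCompatible W u v Hs → FamilyBound u v G′ Hs
  families Hs compatible@(_ , Hs! , members) with cover Hs x v₁ in xv₁
  ... | false = family-avoiding-xv₁ Hs compatible xv₁
  ... | true with cover⇒∃ Hs xv₁
  ...   | S , S∈Hs , x∈S , v₁∈S = ThroughXv₁.bound Hs Hs! members S∈Hs x∈S v₁∈S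

  G′-sparse : UVSparse W G′ u v
  G′-sparse = uvSparse u v single-set families

lemma4p12 : {n : ℕ} (adj : Adj n) → IsSimple adj →
    (u v z x v₁ v₂ v₃ : Fin n) →
    UVSparse ⊤ adj u v →
    u ≢ v →
    z ≢ u → z ≢ v →
    v₁ ≢ v₂ → v₁ ≢ v₃ → v₂ ≢ v₃ →
    (∀ w → (adj z w ≡ true) ⇔ (w ≡ v₁ ⊎ w ≡ v₂ ⊎ w ≡ v₃)) →
    ¬ (adj z u ≡ true × adj z v ≡ true) →
    adj v₁ v₂ ≡ true → adj v₁ v₃ ≡ true → adj v₂ v₃ ≡ true →
    x ≢ z → x ≢ v₁ → x ≢ v₂ → x ≢ v₃ →
    (∀ w → (adj x w ≡ true × adj z w ≡ true) ⇔ (w ≡ v₂ ⊎ w ≡ v₃)) →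
    ¬ ((v₁ ≡ u × x ≡ v) ⊎ (v₁ ≡ v × x ≡ u)) →
    UVSparse (∁ ⁅ z ⁆) (contract4 adj z x v₁) u v
lemma4p12 adj simple u v z x v₁ v₂ v₃ sparse u≢v z≢u z≢v _ _ _ N[z] _ v₁v₂ v₁v₃ v₂v₃ x≢z x≢v₁ _ _ N[x]∩N[z] xv₁≢uv =
  Contraction.G′-sparse adj simple u v z x v₁ v₂ v₃ sparse u≢v z≢u z≢v x≢z x≢v₁
    (from (N[z] v₁) (inj₁ refl)) (from (N[z] v₂) (inj₂ (inj₁ refl))) (from (N[z] v₃) (inj₂ (inj₂ refl)))
    (proj₁ (from (N[x]∩N[z] v₂) (inj₁ refl))) (proj₁ (from (N[x]∩N[z] v₃) (inj₂ refl)))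
    v₁v₂ v₁v₃ v₂v₃ xv₁≢uv
  where
  open import Data.Sum using (inj₁; inj₂)
  open import Data.Product using (proj₁)
  open import Relation.Binary.PropositionalEquality using (refl)
  open Function.Bundles.Equivalence using (from)
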